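{- Let $G$ be a weighted graph with a fixed linear ordering of $V(G)$. Then $$X_G=(-1)^{|V(G)|}\sum_{\gamma\in\mathcal{AO}(G)}(-1)^{\ell(\lambda(\gamma))}p_{\lambda(\gamma)},$$ where $\mathcal{AO}(G)$ is the set of acyclic orientations of $G$ and $\lambda(\gamma)$ is the partition whose parts are the total weights of the source components of $\gamma$.
   Context: Weighted graph: finite simple graph with vertex weights $w:V(G)\to\{1,2,\dots\}$. $X_G=\sum_\kappa\prod_v x_{\kappa(v)}^{w(v)}$ over proper colorings $\kappa:V(G)\to\{1,2,\dots\}$; $p_n=\sum_i x_i^n$, $p_\lambda=p_{\lambda_1}\cdots p_{\lambda_\ell}$, and $\ell(\lambda)$ is the number of parts. Source components of an acyclic orientation $\gamma$ (with respect to the fixed vertex order) are built recursively, starting with all vertices unused: take the first unused vertex as the source of a new component, add to this component every unused vertex reachable from it by a directed path in $\gamma$, mark these vertices used, and repeat until all vertices are used. -}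

module Defs where

open import Level using (Level)
open import Data.Nat using (ℕ; zero; suc; _≤_)
import Data.Nat as ℕ
open import Data.Fin using (Fin; zero; suc; _≟_)
open import Data.Bool using (Bool; true; false; _∧_; _∨_; not; if_then_else_)
open import Data.List using (List; []; _∷_; map; concatMap; allFin; filterᵇ; foldr; length)
open import Data.Bool.ListAction using (all; any)
open import Relation.Nullary.Decidable using (⌊_⌋)
open import Relation.Binary.PropositionalEquality using (_≡_)
open import Algebra.Bundles using (CommutativeRing)

-- Weighted graphs on the vertex set Fin n.  The fixed linear ordering
-- of V(G) is the natural order 0 < 1 < … < n-1 of Fin n.

record WGraph (n : ℕ) : Set where
  field
    adj    : Fin n → Fin n → Bool
    adj-sym    : ∀ i j → adj i j ≡ adj j i
    adj-irrefl : ∀ i → adj i i ≡ false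
    weight     : Fin n → ℕ
    weight-pos : ∀ i → 1 ≤ weight i

open WGraph public

funs : ∀ {b} {B : Set b} (n : ℕ) → List B → List (Fin n → B)
funs zero    xs = (λ ()) ∷ []
funs (suc n) xs =
  concatMap (λ y → map (λ f → λ { zero → y ; (suc i) → f i }) (funs n xs)) xs

bools : List Bool
bools = true ∷ false ∷ []

allB : ∀ {n} → (Fin n → Bool) → Bool
allB {n} p = all p (allFin n)

anyB : ∀ {n} → (Fin n → Bool) → Bool
anyB {n} p = any p (allFin n)

_==_ : ∀ {n} → Fin n → Fin n → Bool
i == j = ⌊ i ≟ j ⌋

sumℕ : List ℕ → ℕ
sumℕ = foldr ℕ._+_ 0

isProper : ∀ {n N} → WGraph n → (Fin n → Fin N) → Bool
isProper G κ = allB (λ i → allB (λ j → not (adj G i j ∧ (κ i == κ j))))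

-- A directed graph on Fin n is o : Fin n → Fin n → Bool
-- (o i j = true means an arc i → j).

Digraph : ℕ → Set
Digraph n = Fin n → Fin n → Bool

isOrientation : ∀ {n} → WGraph n → Digraph n → Bool
isOrientation G o = allB (λ i → allB (λ j →
  (not (o i j) ∨ adj G i j) ∧
  (not (adj G i j) ∨ (o i j ∨ o j i)) ∧
  not (o i j ∧ o j i)))

-- walkB o k i j : there is a directed walk i → … → j with between 1
-- and k+1 arcs.
walkB : ∀ {n} → Digraph n → ℕ → Fin n → Fin n → Bool
walkB o zero    i j = o i j
walkB o (suc k) i j = o i j ∨ anyB (λ m → o i m ∧ walkB o k m j)

-- reachB o i j : there is a directed path from i to j using at least
-- one arc (a shortest such walk has at most n arcs).
reachB : ∀ {n} → Digraph n → Fin n → Fin n → Bool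
reachB {n} o = walkB o n

isAcyclic : ∀ {n} → Digraph n → Bool
isAcyclic o = allB (λ i → not (reachB o i i))

isAcyclicOrientation : ∀ {n} → WGraph n → Digraph n → Bool
isAcyclicOrientation G o = isOrientation G o ∧ isAcyclic o

AO : ∀ {n} → WGraph n → List (Digraph n)
AO {n} G = filterᵇ (isAcyclicOrientation G) (funs n (funs n bools))

-- Source components and λ(γ): scan the vertices in order; the first
-- unused vertex v is the source of a new component consisting of v
-- and every unused vertex reachable from v; record its total weight.

private
  scan : ∀ {n} → WGraph n → Digraph n → List (Fin n) → (Fin n → Bool) → List ℕ
  scan G o []       used = []
  scan G o (v ∷ vs) used =
    if used v then scan G o vs used
    else (let C = λ u → not (used u) ∧ ((v == u) ∨ reachB o v u) in
          sumℕ (map (weight G) (filterᵇ C (allFin _)))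
            ∷ scan G o vs (λ u → used u ∨ C u))

-- parts of λ(γ) (total weights of the source components, in order of
-- creation; the order is irrelevant for p_λ and ℓ(λ))
sourceWeights : ∀ {n} → WGraph n → Digraph n → List ℕ
sourceWeights {n} G o = scan G o (allFin n) (λ _ → false)

-- Symmetric functions, specialised to N variables x : Fin N → R in an
-- arbitrary commutative ring R.

module _ {c ℓ : Level} (R : CommutativeRing c ℓ) where
  open CommutativeRing R

  pow : Carrier → ℕ → Carrier
  pow a zero    = 1#
  pow a (suc k) = a * pow a k

  sumR : List Carrier → Carrier
  sumR = foldr _+_ 0#

  prodR : List Carrier → Carrier
  prodR = foldr _*_ 1#

  sgn : ℕ → Carrier
  sgn m = pow (- 1#) m

  pSum : ∀ {N} → (Fin N → Carrier) → ℕ → Carrier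
  pSum {N} x k = sumR (map (λ i → pow (x i) k) (allFin N))

  pPart : ∀ {N} → (Fin N → Carrier) → List ℕ → Carrier
  pPart x λ′ = prodR (map (pSum x) λ′)

  -- X_G(x_1,…,x_N,0,0,…) = Σ_{κ proper} Π_v x_{κ(v)}^{w(v)}
  chromSym : ∀ {n N} → WGraph n → (Fin N → Carrier) → Carrier
  chromSym {n} {N} G x =
    sumR (map (λ κ → prodR (map (λ v → pow (x (κ v)) (weight G v)) (allFin n)))
              (filterᵇ (isProper G) (funs n (allFin N))))

  aoExpansion : ∀ {n N} → WGraph n → (Fin N → Carrier) → Carrier
  aoExpansion {n} G x =
    sgn n * sumR (map (λ γ → sgn (length (sourceWeights G γ)) * pPart x (sourceWeights G γ))
                      (AO G))

-- Both sides satisfy the deletion–contraction recurrence F(G) = F(G∖e) − F(G/e) for an edge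
-- e = aw at the least non-isolated vertex a, and both equal ∏_v p_{w(v)} on edgeless graphs.
-- For X_G the recurrence comes from splitting the proper colourings of G∖e according to whether
-- a and w get the same colour. The acyclic orientations of G fall into three classes: w → a;
-- a → w together with another path from a to w; a → w as the only such path. Deleting e maps
-- the first two classes bijectively onto the acyclic orientations of G∖e in which a does not,
-- resp. does, reach w, and contracting e maps the third class onto those of G/e. These maps
-- preserve λ(γ): the source of the component of u is the least vertex from which u can be
-- reached, and a, being the least non-isolated vertex, is the source of everything it reaches.
-- Since G/e has one vertex fewer, the factor (−1)^|V| turns the resulting identity of sums
-- into the recurrence.

module Submission where

open import Defs
open import Level using (Level; _⊔_)
open import Data.Nat as ℕ using (ℕ; zero; suc; z≤n; s≤s)
import Data.Nat.Properties as ℕ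
open import Data.Fin as Fin using (Fin; zero; suc; _≤_; _<_; punchIn; punchOut)
import Data.Fin.Properties as Fin
open import Data.Bool using (Bool; true; false; _∧_; _∨_; not; if_then_else_)
open import Data.Bool.Properties as Bool using (not-¬; ¬-not; not-injective; ∨-conicalˡ; ∨-conicalʳ; T-≡; ∧-comm; ∨-comm; ∧-zeroʳ; ∧-identityʳ; if-float)
open import Data.Bool.ListAction using (and)
open import Data.List using (List; []; _∷_; map; allFin; length; filterᵇ; foldr; _++_; concatMap; tabulate)
open import Data.List.Properties using (length-tabulate; length-removeAt′; length-map; map-cong; map-tabulate; map-∘; filter-all)
open import Data.List.Relation.Unary.Any as Any using (Any; here; there; any?; satisfied; index; _─_)
open import Data.List.Relation.Unary.Any.Properties using (any⁺; any⁻)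
open import Data.List.Relation.Unary.All as All using (All; []; _∷_)
open import Data.List.Relation.Unary.All.Properties using (all⁺; all⁻; ¬Any⇒All¬; All¬⇒¬Any)
open import Data.List.Relation.Unary.AllPairs using (AllPairs; []; _∷_)
open import Data.List.Relation.Unary.AllPairs.Properties using (tabulate⁺-<)
open import Data.List.Relation.Unary.Unique.Propositional using (Unique)
open import Data.List.Membership.Propositional using (_∈_; _∉_)
open import Data.List.Membership.Propositional.Properties using (∈-allFin)
open import Data.Product as Product using (Σ; ∃; ∃₂; _×_; _,_; proj₁; proj₂)
open import Data.Sum as Sum using (_⊎_; inj₁; inj₂; [_,_]′)
open import Data.Empty using (⊥; ⊥-elim)
import Data.Vec.Functional as Vector
import Data.Vec.Functional.Relation.Binary.Pointwise.Properties as Pointwise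
open import Relation.Unary using (Pred)
open import Relation.Nullary using (¬_; Dec; yes; no; does; _×-dec_)
open import Relation.Nullary.Decidable using (T?; dec-true; dec-false; does-⇔; isYes≗does)
open import Relation.Binary.Bundles using (DecSetoid)
open import Relation.Binary.PropositionalEquality as ≡ using (_≡_; _≢_; refl; sym; trans; cong; cong₂; subst; subst₂; ≢-sym; module ≡-Reasoning)
open import Algebra.Bundles using (CommutativeMonoid; CommutativeRing)
open import Function using (_∘_; _⇔_; mk⇔; Equivalence)

∨-introˡ : ∀ {a} b → a ≡ true → a ∨ b ≡ true
∨-introˡ b refl = refl

∨-introʳ : ∀ a {b} → b ≡ true → a ∨ b ≡ true
∨-introʳ true  _ = refl
∨-introʳ false p = p

∨-elim : ∀ a {b} → a ∨ b ≡ true → a ≡ true ⊎ b ≡ true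
∨-elim true  _ = inj₁ refl
∨-elim false p = inj₂ p

∧-intro : ∀ {a b} → a ≡ true → b ≡ true → a ∧ b ≡ true
∧-intro refl refl = refl

∧-elimˡ : ∀ a {b} → a ∧ b ≡ true → a ≡ true
∧-elimˡ true _ = refl

∧-elimʳ : ∀ a {b} → a ∧ b ≡ true → b ≡ true
∧-elimʳ true p = p

true-⇔⇒≡ : ∀ {a b : Bool} → (a ≡ true → b ≡ true) → (b ≡ true → a ≡ true) → a ≡ b
true-⇔⇒≡ {true}          f g = sym (f refl)
true-⇔⇒≡ {false} {true}  f g = g refl
true-⇔⇒≡ {false} {false} f g = refl

does-sound : ∀ {p} {P : Set p} (d : Dec P) → does d ≡ true → P
does-sound (yes p) _ = p

==-sound : ∀ {m} (i j : Fin m) → (i == j) ≡ true → i ≡ j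
==-sound i j h with i Fin.≟ j
... | yes i≡j = i≡j
... | no  _   = ⊥-elim (not-¬ h refl)

==-complete : ∀ {m} {i j : Fin m} → i ≡ j → (i == j) ≡ true
==-complete {i = i} {j} i≡j = trans (isYes≗does (i Fin.≟ j)) (dec-true (i Fin.≟ j) i≡j)

==-refl : ∀ {m} (i : Fin m) → (i == i) ≡ true
==-refl i = ==-complete refl

==-false : ∀ {m} {i j : Fin m} → i ≢ j → (i == j) ≡ false
==-false {i = i} {j} i≢j = trans (isYes≗does (i Fin.≟ j)) (dec-false (i Fin.≟ j) i≢j)

anyB-intro : ∀ {n} (p : Fin n → Bool) x → p x ≡ true → anyB p ≡ true
anyB-intro p x px =
  Equivalence.to T-≡ (any⁺ p (Any.map (λ { refl → Equivalence.from T-≡ px }) (∈-allFin x)))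

anyB-elim : ∀ {n} (p : Fin n → Bool) → anyB p ≡ true → ∃ λ x → p x ≡ true
anyB-elim {n} p h =
  Product.map₂ (Equivalence.to T-≡) (satisfied (any⁻ p (allFin n) (Equivalence.from T-≡ h)))

allB-intro : ∀ {n} (p : Fin n → Bool) → (∀ x → p x ≡ true) → allB p ≡ true
allB-intro {n} p h = Equivalence.to T-≡ (all⁻ p (All.tabulate {xs = allFin n} (λ {x} _ → Equivalence.from T-≡ (h x))))

allB-elim : ∀ {n} (p : Fin n → Bool) → allB p ≡ true → ∀ x → p x ≡ true
allB-elim {n} p h x =
  Equivalence.to T-≡ (All.lookup (all⁺ p (allFin n) (Equivalence.from T-≡ h)) (∈-allFin x))

allB-cong : ∀ {n} {p q : Fin n → Bool} → (∀ i → p i ≡ q i) → allB p ≡ allB q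
allB-cong {n} p≡q = cong and (map-cong p≡q (allFin n))

filterᵇ-cong : ∀ {a} {A : Set a} {p q : A → Bool} → (∀ x → p x ≡ q x) → ∀ xs → filterᵇ p xs ≡ filterᵇ q xs
filterᵇ-cong         e []       = refl
filterᵇ-cong {q = q} e (x ∷ xs) rewrite e x with q x
... | true  = cong (x ∷_) (filterᵇ-cong e xs)
... | false = filterᵇ-cong e xs

filterᵇ-accept : ∀ {a} {A : Set a} (p : A → Bool) {x} xs → p x ≡ true → filterᵇ p (x ∷ xs) ≡ x ∷ filterᵇ p xs
filterᵇ-accept p xs px rewrite px = refl

filterᵇ-reject : ∀ {a} {A : Set a} (p : A → Bool) {x} xs → p x ≡ false → filterᵇ p (x ∷ xs) ≡ filterᵇ p xs
filterᵇ-reject p xs px rewrite px = refl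

∈-─ : ∀ {a} {A : Set a} {x y : A} {ys : List A} (p : x ∈ ys) → y ∈ ys → y ≢ x → y ∈ (ys ─ p)
∈-─ (here refl) (here refl) y≢x = ⊥-elim (y≢x refl)
∈-─ (here _)    (there q)   _   = q
∈-─ (there p)   (here y≡z)  _   = here y≡z
∈-─ (there p)   (there q)   y≢x = there (∈-─ p q y≢x)

unique-length-≤ : ∀ {a} {A : Set a} {xs ys : List A} → Unique xs → (∀ {y} → y ∈ xs → y ∈ ys) →
                  length xs ℕ.≤ length ys
unique-length-≤ {xs = []}     _            _   = z≤n
unique-length-≤ {xs = x ∷ xs} {ys} (x≢ ∷ u) sub =
  subst (suc (length xs) ℕ.≤_) (sym (length-removeAt′ ys (index x∈ys)))
    (s≤s (unique-length-≤ u (λ y∈xs → ∈-─ x∈ys (sub (there y∈xs)) (≢-sym (All.lookup x≢ y∈xs)))))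
  where x∈ys = sub (here refl)

unique-length-≤-Fin : ∀ {m} {xs : List (Fin m)} → Unique xs → length xs ℕ.≤ m
unique-length-≤-Fin {m} {xs} u =
  subst (length xs ℕ.≤_) (length-tabulate {n = m} (λ i → i)) (unique-length-≤ u (λ {y} _ → ∈-allFin y))

allFin-suc : ∀ n → allFin (suc n) ≡ zero ∷ map suc (allFin n)
allFin-suc n = cong (zero ∷_) (sym (map-tabulate (λ i → i) suc))

filterᵇ-cons : ∀ {a} {A : Set a} (p : A → Bool) x xs → filterᵇ p (x ∷ xs) ≡ (if p x then x ∷ filterᵇ p xs else filterᵇ p xs)
filterᵇ-cons p x xs with p x
... | true  = refl
... | false = refl

filterᵇ-map : ∀ {a b} {A : Set a} {B : Set b} (p : B → Bool) (f : A → B) xs →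
              filterᵇ p (map f xs) ≡ map f (filterᵇ (p ∘ f) xs)
filterᵇ-map p f []       = refl
filterᵇ-map p f (x ∷ xs) with p (f x)
... | true  = cong (f x ∷_) (filterᵇ-map p f xs)
... | false = filterᵇ-map p f xs

filterᵇ-allFin-punchIn : ∀ {n} (t : Fin (suc n)) (p : Fin (suc n) → Bool) → p t ≡ false →
                         filterᵇ p (allFin (suc n)) ≡ map (punchIn t) (filterᵇ (p ∘ punchIn t) (allFin n))
filterᵇ-allFin-punchIn {n} zero p p0≡false =
  trans (cong (filterᵇ p) (allFin-suc n))
 (trans (filterᵇ-reject p _ p0≡false)
        (filterᵇ-map p suc (allFin n)))
filterᵇ-allFin-punchIn {suc n} (suc t) p pt≡false = begin
  filterᵇ p (allFin (suc (suc n)))                    ≡⟨ cong (filterᵇ p) (allFin-suc (suc n)) ⟩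
  filterᵇ p (zero ∷ map suc (allFin (suc n)))         ≡⟨ filterᵇ-cons p zero _ ⟩
  (if p zero then zero ∷ A else A)                    ≡⟨ cong (λ L → if p zero then zero ∷ L else L) tail ⟩
  (if p zero then zero ∷ map σ B else map σ B)        ≡⟨ if-float (map σ) (p zero) ⟨
  map σ (if p zero then zero ∷ B else B)              ≡⟨ cong (map σ) (filterᵇ-cons (p ∘ σ) zero _) ⟨
  map σ (filterᵇ (p ∘ σ) (zero ∷ map suc (allFin n))) ≡⟨ cong (map σ ∘ filterᵇ (p ∘ σ)) (allFin-suc n) ⟨
  map σ (filterᵇ (p ∘ σ) (allFin (suc n)))            ∎
  where
  open ≡-Reasoning
  σ = punchIn (suc t)
  A = filterᵇ p (map suc (allFin (suc n)))
  B = filterᵇ (p ∘ σ) (map suc (allFin n))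
  tail : A ≡ map σ B
  tail = begin
    filterᵇ p (map suc (allFin (suc n)))                                     ≡⟨ filterᵇ-map p suc _ ⟩
    map suc (filterᵇ (p ∘ suc) (allFin (suc n)))                             ≡⟨ cong (map suc) (filterᵇ-allFin-punchIn t (p ∘ suc) pt≡false) ⟩
    map suc (map (punchIn t) (filterᵇ (p ∘ suc ∘ punchIn t) (allFin n)))      ≡⟨ map-∘ _ ⟨
    map (suc ∘ punchIn t) (filterᵇ (p ∘ suc ∘ punchIn t) (allFin n))          ≡⟨ map-∘ _ ⟩
    map σ (map suc (filterᵇ (p ∘ σ ∘ suc) (allFin n)))                        ≡⟨ cong (map σ) (filterᵇ-map (p ∘ σ) suc (allFin n)) ⟨
    map σ B                                                                   ∎

data Walk {m} (o : Digraph m) : Fin m → Fin m → Set where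
  arc : ∀ {i j} → o i j ≡ true → Walk o i j
  _◅_ : ∀ {i k j} → o i k ≡ true → Walk o k j → Walk o i j

infixr 5 _◅_

module _ {m : ℕ} {o : Digraph m} where

  infixr 5 _◅◅_

  _◅◅_ : ∀ {i k j} → Walk o i k → Walk o k j → Walk o i j
  arc h    ◅◅ w′ = h ◅ w′
  (h ◅ w) ◅◅ w′ = h ◅ (w ◅◅ w′)

  targets : ∀ {i j} → Walk o i j → List (Fin m)
  targets (arc {j = j} _)   = j ∷ []
  targets (_◅_ {k = k} _ w) = k ∷ targets w

  walkB-sound : ∀ k i j → walkB o k i j ≡ true → Walk o i j
  walkB-sound zero    i j h = arc h
  walkB-sound (suc k) i j h with ∨-elim (o i j) h
  ... | inj₁ h′ = arc h′
  ... | inj₂ h′ with anyB-elim (λ x → o i x ∧ walkB o k x j) h′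
  ...   | x , h″ = ∧-elimˡ (o i x) h″ ◅ walkB-sound k x j (∧-elimʳ (o i x) h″)

  walkB-complete : ∀ {i j} (w : Walk o i j) k → length (targets w) ℕ.≤ suc k → walkB o k i j ≡ true
  walkB-complete (arc h) zero    _ = h
  walkB-complete (arc h) (suc k) _ = ∨-introˡ _ h
  walkB-complete {i} {j} (_◅_ {k = x} h w) (suc k) (s≤s len≤) =
    ∨-introʳ (o i j) (anyB-intro (λ y → o i y ∧ walkB o k y j) x (∧-intro h (walkB-complete w k len≤)))
  walkB-complete (_ ◅ arc _)   zero (s≤s ())
  walkB-complete (_ ◅ (_ ◅ _)) zero (s≤s ())

  private
    suffix-from : ∀ {k j x} (w : Walk o k j) → Unique (targets w) → x ∈ targets w →
                 x ≡ j ⊎ Σ (Walk o x j) (λ w′ → Unique (targets w′) × x ∉ targets w′)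
    suffix-from (arc _) _          (here refl) = inj₁ refl
    suffix-from (_ ◅ w) (k≢ ∷ u)  (here refl) = inj₂ (w , u , All¬⇒¬Any k≢)
    suffix-from (_ ◅ w) (_ ∷ u)   (there x∈)  = suffix-from w u x∈

  shorten : ∀ {i j} → Walk o i j → Σ (Walk o i j) (Unique ∘ targets)
  shorten (arc h) = arc h , [] ∷ []
  shorten (_◅_ {k = k} h w) with shorten w
  ... | w′ , u with any? (k Fin.≟_) (targets w′)
  ...   | no k∉ = h ◅ w′ , ¬Any⇒All¬ _ k∉ ∷ u
  ...   | yes k∈ with suffix-from w′ u k∈
  ...     | inj₁ refl               = arc h , [] ∷ []
  ...     | inj₂ (w″ , u″ , k∉) = h ◅ w″ , ¬Any⇒All¬ _ k∉ ∷ u″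

  reachB-sound : ∀ {i j} → reachB o i j ≡ true → Walk o i j
  reachB-sound {i} {j} = walkB-sound m i j

  -- reachB only inspects walks of at most m + 1 arcs, and a shortened walk has at most m.
  reachB-complete : ∀ {i j} → Walk o i j → reachB o i j ≡ true
  reachB-complete w with shorten w
  ... | w′ , u = walkB-complete w′ m (ℕ.m≤n⇒m≤1+n (unique-length-≤-Fin u))

mapWalk : ∀ {m} {o o′ : Digraph m} → (∀ {i j} → o i j ≡ true → o′ i j ≡ true) →
          ∀ {i j} → Walk o i j → Walk o′ i j
mapWalk f (arc h)  = arc (f h)
mapWalk f (h ◅ w) = f h ◅ mapWalk f w

Reach : ∀ {m} → Digraph m → Fin m → Fin m → Set
Reach o s u = s ≡ u ⊎ Walk o s u

module _ {m : ℕ} {o : Digraph m} where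

  Reach-trans : ∀ {s t u} → Reach o s t → Reach o t u → Reach o s u
  Reach-trans (inj₁ refl) r           = r
  Reach-trans (inj₂ w)    (inj₁ refl) = inj₂ w
  Reach-trans (inj₂ w)    (inj₂ w′)   = inj₂ (w ◅◅ w′)

  reach? : ∀ s u → Dec (Reach o s u)
  reach? s u with s Fin.≟ u | reachB o s u in e
  ... | yes s≡u | _     = yes (inj₁ s≡u)
  ... | no  _   | true  = yes (inj₂ (reachB-sound e))
  ... | no  s≢u | false = no [ s≢u , (λ w → not-¬ (reachB-complete w) e) ]′

Reach⇒Walk : ∀ {m} {o : Digraph m} {s u} → s ≢ u → Reach o s u → Walk o s u
Reach⇒Walk s≢u (inj₁ s≡u) = ⊥-elim (s≢u s≡u)
Reach⇒Walk s≢u (inj₂ W)   = W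

mapReach : ∀ {m} {o o′ : Digraph m} → (∀ {i j} → o i j ≡ true → o′ i j ≡ true) →
           ∀ {s u} → Reach o s u → Reach o′ s u
mapReach f (inj₁ e) = inj₁ e
mapReach f (inj₂ w) = inj₂ (mapWalk f w)

first-arc : ∀ {m} {o : Digraph m} {s u} → Walk o s u → ∃ λ k → o s k ≡ true
first-arc (arc h)  = _ , h
first-arc (h ◅ _) = _ , h

last-arc : ∀ {m} {o : Digraph m} {s u} → Walk o s u → ∃ λ k → o k u ≡ true
last-arc (arc h)  = _ , h
last-arc (_ ◅ W) = last-arc W

record Orientation {m} (G : WGraph m) (o : Digraph m) : Set where
  field
    arc⇒edge : ∀ {i j} → o i j ≡ true → adj G i j ≡ true
    edge⇒arc : ∀ {i j} → adj G i j ≡ true → o i j ≡ true ⊎ o j i ≡ true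
    antisym  : ∀ {i j} → o i j ≡ true → o j i ≡ true → ⊥

Acyclic : ∀ {m} → Digraph m → Set
Acyclic o = ∀ i → ¬ Walk o i i

module _ {m : ℕ} (G : WGraph m) (o : Digraph m) where

  isOrientation-sound : isOrientation G o ≡ true → Orientation G o
  isOrientation-sound h = record
    { arc⇒edge = λ {i} {j} → arc⇒edge′ (at i j)
    ; edge⇒arc = λ {i} {j} → edge⇒arc′ {not (o i j) ∨ adj G i j} (at i j)
    ; antisym  = λ {i} {j} → antisym′ {not (o i j) ∨ adj G i j} {not (adj G i j) ∨ (o i j ∨ o j i)} (at i j)
    }
    where
    at : ∀ i j → ((not (o i j) ∨ adj G i j) ∧ (not (adj G i j) ∨ (o i j ∨ o j i)) ∧ not (o i j ∧ o j i)) ≡ true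
    at i j = allB-elim _ (allB-elim _ h i) j
    arc⇒edge′ : ∀ {b c d} → ((not b ∨ c) ∧ d) ≡ true → b ≡ true → c ≡ true
    arc⇒edge′ h′ refl = ∧-elimˡ _ h′
    edge⇒arc′ : ∀ {b c x y d} → (b ∧ (not c ∨ (x ∨ y)) ∧ d) ≡ true → c ≡ true → x ≡ true ⊎ y ≡ true
    edge⇒arc′ {b} h′ refl = ∨-elim _ (∧-elimˡ _ (∧-elimʳ b h′))
    antisym′ : ∀ {b c x y} → (b ∧ c ∧ not (x ∧ y)) ≡ true → x ≡ true → y ≡ true → ⊥
    antisym′ {b} {c} h′ refl refl = not-¬ (∧-elimʳ c (∧-elimʳ b h′)) refl

  isOrientation-complete : Orientation G o → isOrientation G o ≡ true
  isOrientation-complete O = allB-intro _ λ i → allB-intro _ λ j → local i j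
    where
    open Orientation O
    local : ∀ i j → ((not (o i j) ∨ adj G i j) ∧ (not (adj G i j) ∨ (o i j ∨ o j i)) ∧ not (o i j ∧ o j i)) ≡ true
    local i j with o i j in oij | o j i in oji | adj G i j in eij
    ... | true  | true  | _     = ⊥-elim (antisym oij oji)
    ... | true  | false | true  = refl
    ... | true  | false | false = ⊥-elim (not-¬ (arc⇒edge oij) eij)
    ... | false | true  | true  = refl
    ... | false | _     | false = refl
    ... | false | false | true  = ⊥-elim ([ (λ e → not-¬ e oij) , (λ e → not-¬ e oji) ]′ (edge⇒arc eij))

  isAcyclic-sound : isAcyclic o ≡ true → Acyclic o
  isAcyclic-sound h i w = not-¬ (reachB-complete w) (not-injective (allB-elim _ h i))

  isAcyclic-complete : Acyclic o → isAcyclic o ≡ true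
  isAcyclic-complete A = allB-intro _ λ i → cong not (¬-not (A i ∘ reachB-sound))

  isAcyclicOrientation-sound : isAcyclicOrientation G o ≡ true → Orientation G o × Acyclic o
  isAcyclicOrientation-sound h = isOrientation-sound (∧-elimˡ _ h) , isAcyclic-sound (∧-elimʳ (isOrientation G o) h)

  isAcyclicOrientation-complete : Orientation G o → Acyclic o → isAcyclicOrientation G o ≡ true
  isAcyclicOrientation-complete O A = ∧-intro (isOrientation-complete O) (isAcyclic-complete A)

least-satisfying : ∀ {m p} {P : Pred (Fin m) p} → (∀ i → Dec (P i)) → ∀ {t} → P t →
        Σ (Fin m) λ i → P i × (∀ {s} → P s → i ≤ s)
least-satisfying {suc m} P? {t} Pt with P? zero
... | yes P0 = zero , P0 , λ _ → z≤n
least-satisfying {suc m} P? {zero}  Pt | no ¬P0 = ⊥-elim (¬P0 Pt)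
least-satisfying {suc m} P? {suc t} Pt | no ¬P0 with least-satisfying (P? ∘ suc) Pt
... | i , Pi , min = suc i , Pi , λ { {zero} P0 → ⊥-elim (¬P0 P0) ; {suc s} Ps → s≤s (min Ps) }

module _ {m : ℕ} (o : Digraph m) where

  root : Fin m → Fin m
  root u = proj₁ (least-satisfying (λ s → reach? {o = o} s u) (inj₁ refl))

  root-reaches : ∀ u → Reach o (root u) u
  root-reaches u = proj₁ (proj₂ (least-satisfying (λ s → reach? {o = o} s u) (inj₁ refl)))

  root-least : ∀ {s u} → Reach o s u → root u ≤ s
  root-least {u = u} = proj₂ (proj₂ (least-satisfying (λ s → reach? {o = o} s u) (inj₁ refl)))

  root-unique : ∀ {t u} → Reach o t u → (∀ {s} → Reach o s u → t ≤ s) → root u ≡ t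
  root-unique t⇝u min = Fin.≤-antisym (root-least t⇝u) (min (root-reaches _))

  root-≤ : ∀ u → root u ≤ u
  root-≤ u = root-least (inj₁ refl)

  root-idem : ∀ u → root (root u) ≡ root u
  root-idem u = Fin.≤-antisym (root-≤ (root u))
    (root-least (Reach-trans (root-reaches (root u)) (root-reaches u)))

  isRoot : Fin m → Bool
  isRoot s = root s == s

  componentWeight : WGraph m → Fin m → ℕ
  componentWeight G s = sumℕ (map (weight G) (filterᵇ (λ u → root u == s) (allFin m)))

root-cong : ∀ {m} (o o′ : Digraph m) u → (∀ {s} → Reach o s u → Reach o′ s u) →
            (∀ {s} → Reach o′ s u → Reach o s u) → root o u ≡ root o′ u
root-cong o o′ u to from = sym (root-unique o′ (to (root-reaches o u)) (root-least o ∘ from))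

-- The scanning function behind sourceWeights is private; abstracting the
-- arguments of its initial call brings it into scope.
expose-scan : ∀ {n} (G : WGraph n) (o : Digraph n) →
             Σ (List (Fin n) → (Fin n → Bool) → List ℕ) λ scan →
               ∀ xs used → xs ≡ allFin n → used ≡ (λ _ → false) → scan xs used ≡ sourceWeights G o
expose-scan {n} G o = _ , exposed
  where
  exposed : ∀ xs used → xs ≡ allFin n → used ≡ (λ _ → false) → _ ≡ sourceWeights G o
  exposed xs used p q with allFin n | (λ (_ : Fin n) → false)
  exposed xs used refl refl | _ | _ = refl

module _ {n : ℕ} (G : WGraph n) (o : Digraph n) where

  private
    scan = proj₁ (expose-scan G o)
    r = root o

  Unscanned : List (Fin n) → (Fin n → Bool) → Set
  Unscanned vs used = ∀ u → used u ≡ false ⇔ r u ∈ vs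

  private
    ∈-head : ∀ {v : Fin n} {vs} → AllPairs _<_ (v ∷ vs) → ∀ {u} → u ≤ v → u ∈ v ∷ vs → u ≡ v
    ∈-head _         _   (here u≡v) = u≡v
    ∈-head (v< ∷ _) u≤v (there u∈) = ⊥-elim (ℕ.<⇒≱ (All.lookup v< u∈) u≤v)

    claimed : (Fin n → Bool) → Fin n → Fin n → Bool
    claimed used v u = not (used u) ∧ ((v == u) ∨ reachB o v u)

    skip : ∀ {v vs used} → Unscanned (v ∷ vs) used → used v ≡ true → isRoot o v ≡ false × Unscanned vs used
    skip {v} {vs} {used} inv used-v = ==-false rv≢v , λ u → mk⇔ (to u) (λ ru∈ → Equivalence.from (inv u) (there ru∈))
      where
      rv≢v : r v ≢ v
      rv≢v rv≡v = not-¬ (Equivalence.from (inv v) (here rv≡v)) used-v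
      to : ∀ u → used u ≡ false → r u ∈ vs
      to u unused with Equivalence.to (inv u) unused
      ... | here ru≡v = ⊥-elim (rv≢v (trans (cong r (sym ru≡v)) (trans (root-idem o u) ru≡v)))
      ... | there ru∈ = ru∈

    take : ∀ {v vs used} → AllPairs _<_ (v ∷ vs) → Unscanned (v ∷ vs) used → used v ≡ false →
           isRoot o v ≡ true × (∀ u → claimed used v u ≡ (r u == v)) × Unscanned vs (λ u → used u ∨ claimed used v u)
    take {v} {vs} {used} sorted@(v< ∷ _) inv used-v =
      ==-complete (∈-head sorted (root-≤ o v) (Equivalence.to (inv v) used-v)) , claimed≡ , λ u → mk⇔ (to u) (from u)
      where
      claimed≡ : ∀ u → claimed used v u ≡ (r u == v)
      claimed≡ u = true-⇔⇒≡ (λ h → ==-complete (∈-head sorted (root-least o (reached (∧-elimʳ _ h)))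
                                                     (Equivalence.to (inv u) (not-injective (∧-elimˡ _ h)))))
                            (λ h → claim (==-sound _ _ h))
        where
        reached : ((v == u) ∨ reachB o v u) ≡ true → Reach o v u
        reached h = Sum.map (==-sound v u) reachB-sound (∨-elim (v == u) h)
        claim : r u ≡ v → claimed used v u ≡ true
        claim refl = ∧-intro (cong not (Equivalence.from (inv u) (here refl)))
                             ([ (λ ru≡u → ∨-introˡ _ (==-complete ru≡u)) , (λ W → ∨-introʳ _ (reachB-complete W)) ]′ (root-reaches o u))
      to : ∀ u → (used u ∨ claimed used v u) ≡ false → r u ∈ vs
      to u h with Equivalence.to (inv u) (∨-conicalˡ _ _ h)
      ... | here ru≡v = ⊥-elim (not-¬ (==-complete ru≡v) (trans (sym (claimed≡ u)) (∨-conicalʳ _ _ h)))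
      ... | there ru∈ = ru∈
      from : ∀ u → r u ∈ vs → (used u ∨ claimed used v u) ≡ false
      from u ru∈ = cong₂ _∨_ (Equivalence.from (inv u) (there ru∈))
                             (trans (claimed≡ u) (==-false (λ ru≡v → ℕ.<-irrefl (cong Fin.toℕ (sym ru≡v)) (All.lookup v< ru∈))))

  scan-components : ∀ vs used → AllPairs _<_ vs → Unscanned vs used →
                    scan vs used ≡ map (componentWeight o G) (filterᵇ (isRoot o) vs)
  scan-components []       used _ _ = refl
  scan-components (v ∷ vs) used sorted@(_ ∷ sorted′) inv with used v in used-v
  ... | true  = let not-root , inv′ = skip inv used-v in
                trans (scan-components vs used sorted′ inv′)
                      (sym (cong (map (componentWeight o G)) (filterᵇ-reject (isRoot o) vs not-root)))
  ... | false = let is-root , claimed≡ , inv′ = take sorted inv used-v in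
                trans (cong₂ _∷_ (cong (sumℕ ∘ map (weight G)) (filterᵇ-cong claimed≡ (allFin n)))
                                 (scan-components vs _ sorted′ inv′))
                      (sym (cong (map (componentWeight o G)) (filterᵇ-accept (isRoot o) vs is-root)))

sourceWeights-components : ∀ {n} (G : WGraph n) (o : Digraph n) →
  sourceWeights G o ≡ map (componentWeight o G) (filterᵇ (isRoot o) (allFin n))
sourceWeights-components {n} G o =
  trans (sym (proj₂ (expose-scan G o) (allFin n) (λ _ → false) refl refl))
        (scan-components G o (allFin n) (λ _ → false) (tabulate⁺-< (λ i<j → i<j))
          (λ u → mk⇔ (λ _ → ∈-allFin (root o u)) (λ _ → refl)))

infix 4 _≐_

_≐_ : ∀ {m} → Digraph m → Digraph m → Set
o ≐ o′ = ∀ i j → o i j ≡ o′ i j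

≐-sym : ∀ {m} {o o′ : Digraph m} → o ≐ o′ → o′ ≐ o
≐-sym o≐o′ i j = sym (o≐o′ i j)

module _ {m : ℕ} {o o′ : Digraph m} (o≐o′ : o ≐ o′) where

  walk-≐ : ∀ {i j} → Walk o i j → Walk o′ i j
  walk-≐ = mapWalk (λ {i} {j} h → trans (sym (o≐o′ i j)) h)

  reachB-≐ : ∀ i j → reachB o i j ≡ reachB o′ i j
  reachB-≐ i j = true-⇔⇒≡ (reachB-complete ∘ walk-≐ ∘ reachB-sound)
                          (reachB-complete ∘ mapWalk (λ {i} {j} h → trans (o≐o′ i j) h) ∘ reachB-sound)

  isAcyclicOrientation-≐ : ∀ (G : WGraph m) → isAcyclicOrientation G o ≡ isAcyclicOrientation G o′
  isAcyclicOrientation-≐ G = cong₂ _∧_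
    (allB-cong λ i → allB-cong λ j →
       cong₂ (λ x y → (not x ∨ adj G i j) ∧ (not (adj G i j) ∨ (x ∨ y)) ∧ not (x ∧ y)) (o≐o′ i j) (o≐o′ j i))
    (allB-cong λ i → cong not (reachB-≐ i i))

sourceWeights-cong : ∀ {m} (G G′ : WGraph m) (o o′ : Digraph m) → (∀ u → weight G u ≡ weight G′ u) →
                     (∀ u → root o u ≡ root o′ u) → sourceWeights G o ≡ sourceWeights G′ o′
sourceWeights-cong {m} G G′ o o′ same-weight same-root = begin
  sourceWeights G o                                             ≡⟨ sourceWeights-components G o ⟩
  map (componentWeight o G) (filterᵇ (isRoot o) (allFin m))     ≡⟨ cong (map _) (filterᵇ-cong (λ s → cong (_== s) (same-root s)) (allFin m)) ⟩
  map (componentWeight o G) (filterᵇ (isRoot o′) (allFin m))    ≡⟨ map-cong same-component _ ⟩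
  map (componentWeight o′ G′) (filterᵇ (isRoot o′) (allFin m))  ≡⟨ sourceWeights-components G′ o′ ⟨
  sourceWeights G′ o′                                           ∎
  where
  open ≡-Reasoning
  same-component : ∀ s → componentWeight o G s ≡ componentWeight o′ G′ s
  same-component s = cong sumℕ (trans (cong (map (weight G)) (filterᵇ-cong (λ u → cong (_== s) (same-root u)) (allFin m)))
                                      (map-cong same-weight _))

sourceWeights-≐ : ∀ {m} (G : WGraph m) {o o′ : Digraph m} → o ≐ o′ → sourceWeights G o ≡ sourceWeights G o′
sourceWeights-≐ G {o} {o′} o≐o′ = sourceWeights-cong G G o o′ (λ _ → refl)
  (λ u → root-cong o o′ u (mapReach (λ {i} {j} h → trans (sym (o≐o′ i j)) h)) (mapReach (λ {i} {j} h → trans (o≐o′ i j) h)))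

module _ {m : ℕ} where

  add : Fin m → Fin m → Digraph m → Digraph m
  add p q o u v = ((u == p) ∧ (v == q)) ∨ o u v

  add-⊇ : ∀ {p q} (o : Digraph m) {u v} → o u v ≡ true → add p q o u v ≡ true
  add-⊇ {p} {q} o {u} {v} = ∨-introʳ ((u == p) ∧ (v == q))

  add-new : ∀ p q (o : Digraph m) → add p q o p q ≡ true
  add-new p q o = ∨-introˡ _ (∧-intro (==-refl p) (==-refl q))

  add-sound : ∀ {p q} (o : Digraph m) {u v} → add p q o u v ≡ true → (u ≡ p × v ≡ q) ⊎ o u v ≡ true
  add-sound {p} {q} o {u} {v} h with ∨-elim ((u == p) ∧ (v == q)) h
  ... | inj₁ h′ = inj₁ (==-sound _ _ (∧-elimˡ _ h′) , ==-sound _ _ (∧-elimʳ (u == p) h′))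
  ... | inj₂ h′ = inj₂ h′

  add-≐ : ∀ p q {o o′ : Digraph m} → o ≐ o′ → add p q o ≐ add p q o′
  add-≐ p q o≐o′ u v = cong (((u == p) ∧ (v == q)) ∨_) (o≐o′ u v)

  add-walk : ∀ {p q} (o : Digraph m) {i j} → Walk (add p q o) i j → Walk o i j ⊎ (Reach o i p × Reach o q j)
  add-walk o (arc h) with add-sound o h
  ... | inj₁ (refl , refl) = inj₂ (inj₁ refl , inj₁ refl)
  ... | inj₂ h′            = inj₁ (arc h′)
  add-walk o (h ◅ W) with add-sound o h | add-walk o W
  ... | inj₁ (refl , refl) | inj₁ W′        = inj₂ (inj₁ refl , inj₂ W′)
  ... | inj₁ (refl , refl) | inj₂ (_ , q⇝j) = inj₂ (inj₁ refl , q⇝j)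
  ... | inj₂ h′            | inj₁ W′        = inj₁ (h′ ◅ W′)
  ... | inj₂ h′            | inj₂ (k⇝p , q⇝j) = inj₂ (Reach-trans (inj₂ (arc h′)) k⇝p , q⇝j)

Digraphs : ℕ → DecSetoid _ _
Digraphs m = Pointwise.decSetoid (Pointwise.decSetoid Bool.≡-decSetoid m) m

module ListSum {c ℓ : Level} (M : CommutativeMonoid c ℓ) where

  open CommutativeMonoid M renaming (refl to ≈-refl; sym to ≈-sym; trans to ≈-trans)
  open import Relation.Binary.Reasoning.Setoid setoid
  open import Algebra.Properties.CommutativeMonoid.Sum M using (sum; sum-remove)

  ∑ : ∀ {a} {A : Set a} → (A → Carrier) → List A → Carrier
  ∑ f xs = foldr _∙_ ε (map f xs)

  module _ {a : Level} {A : Set a} where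

    ∑-cong : ∀ {f g : A → Carrier} xs → (∀ x → f x ≈ g x) → ∑ f xs ≈ ∑ g xs
    ∑-cong []       f≈g = ≈-refl
    ∑-cong (x ∷ xs) f≈g = ∙-cong (f≈g x) (∑-cong xs f≈g)

    ∑-++ : ∀ (f : A → Carrier) xs ys → ∑ f (xs ++ ys) ≈ ∑ f xs ∙ ∑ f ys
    ∑-++ f []       ys = ≈-sym (identityˡ _)
    ∑-++ f (x ∷ xs) ys = ≈-trans (∙-congˡ (∑-++ f xs ys)) (≈-sym (assoc _ _ _))

    ∑-ε : ∀ {f : A → Carrier} xs → (∀ x → f x ≈ ε) → ∑ f xs ≈ ε
    ∑-ε []       _   = ≈-refl
    ∑-ε (x ∷ xs) f≈ε = ≈-trans (∙-cong (f≈ε x) (∑-ε xs f≈ε)) (identityˡ ε)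

    ∑-distrib : ∀ (f g : A → Carrier) xs → ∑ (λ x → f x ∙ g x) xs ≈ ∑ f xs ∙ ∑ g xs
    ∑-distrib f g []       = ≈-sym (identityˡ ε)
    ∑-distrib f g (x ∷ xs) = begin
      (f x ∙ g x) ∙ ∑ (λ x → f x ∙ g x) xs ≈⟨ ∙-congˡ (∑-distrib f g xs) ⟩
      (f x ∙ g x) ∙ (∑ f xs ∙ ∑ g xs)      ≈⟨ assoc _ _ _ ⟩
      f x ∙ (g x ∙ (∑ f xs ∙ ∑ g xs))      ≈⟨ ∙-congˡ (≈-sym (assoc _ _ _)) ⟩
      f x ∙ ((g x ∙ ∑ f xs) ∙ ∑ g xs)      ≈⟨ ∙-congˡ (∙-congʳ (comm _ _)) ⟩
      f x ∙ ((∑ f xs ∙ g x) ∙ ∑ g xs)      ≈⟨ ∙-congˡ (assoc _ _ _) ⟩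
      f x ∙ (∑ f xs ∙ (g x ∙ ∑ g xs))      ≈⟨ ≈-sym (assoc _ _ _) ⟩
      (f x ∙ ∑ f xs) ∙ (g x ∙ ∑ g xs)      ∎

    ∑-filterᵇ : ∀ (p : A → Bool) (f : A → Carrier) xs →
                ∑ f (filterᵇ p xs) ≈ ∑ (λ x → if p x then f x else ε) xs
    ∑-filterᵇ p f []       = ≈-refl
    ∑-filterᵇ p f (x ∷ xs) with p x
    ... | true  = ∙-congˡ (∑-filterᵇ p f xs)
    ... | false = ≈-trans (∑-filterᵇ p f xs) (≈-sym (identityˡ _))

  ∑-map : ∀ {a b} {A : Set a} {B : Set b} (f : B → Carrier) (g : A → B) xs → ∑ f (map g xs) ≡ ∑ (f ∘ g) xs
  ∑-map f g xs = cong (foldr _∙_ ε) (sym (map-∘ xs))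

  ∑-concatMap : ∀ {a b} {A : Set a} {B : Set b} (f : B → Carrier) (g : A → List B) xs →
                ∑ f (concatMap g xs) ≈ ∑ (λ x → ∑ f (g x)) xs
  ∑-concatMap f g []       = ≈-refl
  ∑-concatMap f g (x ∷ xs) = ≈-trans (∑-++ f (g x) (concatMap g xs)) (∙-congˡ (∑-concatMap f g xs))

  ∑-comm : ∀ {a b} {A : Set a} {B : Set b} (f : A → B → Carrier) xs ys →
           ∑ (λ x → ∑ (f x) ys) xs ≈ ∑ (λ y → ∑ (λ x → f x y) xs) ys
  ∑-comm f []       ys = ≈-sym (∑-ε ys (λ _ → ≈-refl))
  ∑-comm f (x ∷ xs) ys = ≈-trans (∙-congˡ (∑-comm f xs ys)) (≈-sym (∑-distrib (f x) _ ys))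

  ∑-funs-suc : ∀ {b} {B : Set b} n (xs : List B) (F : (Fin (suc n) → B) → Carrier) →
               (∀ {f g} → (∀ i → f i ≡ g i) → F f ≈ F g) →
               ∑ F (funs (suc n) xs) ≈ ∑ (λ y → ∑ (λ g → F (y Vector.∷ g)) (funs n xs)) xs
  ∑-funs-suc n xs F F-resp = ≈-trans (∑-concatMap F _ xs) (∑-cong xs (λ y → fixed-head y _ (λ _ → refl) (λ _ _ → refl)))
    where
    -- c abstracts over the anonymous cons with which Defs.funs builds its functions.
    fixed-head : ∀ y c → (∀ g → c g zero ≡ y) → (∀ g i → c g (suc i) ≡ g i) →
                 ∑ F (map c (funs n xs)) ≈ ∑ (λ g → F (y Vector.∷ g)) (funs n xs)
    fixed-head y c c₀ cₛ = ≈-trans (reflexive (∑-map F c (funs n xs)))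
                                   (∑-cong (funs n xs) (λ g → F-resp λ { zero → c₀ g ; (suc i) → cₛ g i }))

  ∑-allFin : ∀ {n} (f : Fin n → Carrier) → ∑ f (allFin n) ≡ sum f
  ∑-allFin {zero}  f = refl
  ∑-allFin {suc n} f = cong (f zero ∙_) (trans (cong (foldr _∙_ ε) tabulate-suc) (∑-allFin (f ∘ suc)))
    where
    tabulate-suc : map f (tabulate suc) ≡ map (f ∘ suc) (allFin n)
    tabulate-suc = trans (map-tabulate suc f) (sym (map-tabulate (λ i → i) (f ∘ suc)))

  ∑-allFin-suc : ∀ {n} (f : Fin (suc n) → Carrier) → ∑ f (allFin (suc n)) ≡ f zero ∙ ∑ (f ∘ suc) (allFin n)
  ∑-allFin-suc f = trans (∑-allFin f) (cong (f zero ∙_) (sym (∑-allFin (f ∘ suc))))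

  ∑-punchIn : ∀ {n} (t : Fin (suc n)) (f : Fin (suc n) → Carrier) →
              ∑ f (allFin (suc n)) ≈ f t ∙ ∑ (f ∘ punchIn t) (allFin n)
  ∑-punchIn t f = begin
    ∑ f (allFin _)                   ≡⟨ ∑-allFin f ⟩
    sum f                            ≈⟨ sum-remove {i = t} f ⟩
    f t ∙ sum (f ∘ punchIn t)        ≡⟨ cong (f t ∙_) (sym (∑-allFin (f ∘ punchIn t))) ⟩
    f t ∙ ∑ (f ∘ punchIn t) (allFin _) ∎

  ∑-single : ∀ {n} (t : Fin n) (f : Fin n → Carrier) → (∀ i → i ≢ t → f i ≈ ε) → ∑ f (allFin n) ≈ f t
  ∑-single {suc n} t f f≈ε = begin
    ∑ f (allFin (suc n))               ≈⟨ ∑-punchIn t f ⟩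
    f t ∙ ∑ (f ∘ punchIn t) (allFin n) ≈⟨ ∙-congˡ (∑-ε (allFin n) (λ i → f≈ε (punchIn t i) (Fin.punchInᵢ≢i t i))) ⟩
    f t ∙ ε                            ≈⟨ identityʳ _ ⟩
    f t                                ∎

  ∑-fibres : ∀ {m k} (ι : Fin m → Fin k) (h : Fin k → Fin m → Carrier) →
             ∑ (λ i → ∑ (h i) (filterᵇ (λ u → ι u == i) (allFin m))) (allFin k) ≈ ∑ (λ u → h (ι u) u) (allFin m)
  ∑-fibres {m} {k} ι h = begin
    ∑ (λ i → ∑ (h i) (filterᵇ (λ u → ι u == i) (allFin m))) (allFin k)
      ≈⟨ ∑-cong (allFin k) (λ i → ∑-filterᵇ _ (h i) (allFin m)) ⟩
    ∑ (λ i → ∑ (λ u → if ι u == i then h i u else ε) (allFin m)) (allFin k)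
      ≈⟨ ∑-comm _ (allFin k) (allFin m) ⟩
    ∑ (λ u → ∑ (λ i → if ι u == i then h i u else ε) (allFin k)) (allFin m)
      ≈⟨ ∑-cong (allFin m) (λ u → ∑-single (ι u) _ (λ i i≢ιu → reflexive (cong (if_then h i u else ε) (==-false (i≢ιu ∘ sym))))) ⟩
    ∑ (λ u → if ι u == ι u then h (ι u) u else ε) (allFin m)
      ≈⟨ ∑-cong (allFin m) (λ u → reflexive (cong (if_then h (ι u) u else ε) (==-refl (ι u)))) ⟩
    ∑ (λ u → h (ι u) u) (allFin m) ∎

module ℕsum = ListSum ℕ.+-0-commutativeMonoid

∑-mono-≤ : ∀ {a} {A : Set a} {f g : A → ℕ} → (∀ x → f x ℕ.≤ g x) → ∀ xs → ℕsum.∑ f xs ℕ.≤ ℕsum.∑ g xs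
∑-mono-≤ f≤g []       = ℕ.≤-refl
∑-mono-≤ f≤g (x ∷ xs) = ℕ.+-mono-≤ (f≤g x) (∑-mono-≤ f≤g xs)

∑-mono-< : ∀ {k} {f g : Fin (suc k) → ℕ} → (∀ x → f x ℕ.≤ g x) → ∀ t → f t ℕ.< g t →
           ℕsum.∑ f (allFin (suc k)) ℕ.< ℕsum.∑ g (allFin (suc k))
∑-mono-< {f = f} {g} f≤g t ft<gt =
  subst₂ ℕ._<_ (sym (ℕsum.∑-punchIn t f)) (sym (ℕsum.∑-punchIn t g))
         (ℕ.+-mono-<-≤ ft<gt (∑-mono-≤ (f≤g ∘ Fin.punchIn t) (allFin _)))

module _ {a₁ ℓ₁ a₂ ℓ₂ : Level} (S : DecSetoid a₁ ℓ₁) (T : DecSetoid a₂ ℓ₂) where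

  private
    module S = DecSetoid S
    module T = DecSetoid T

  record SubsetBijection (P : S.Carrier → Bool) (Q : T.Carrier → Bool) : Set (a₁ ⊔ ℓ₁ ⊔ a₂ ⊔ ℓ₂) where
    field
      to        : S.Carrier → T.Carrier
      from      : T.Carrier → S.Carrier
      to-cong   : ∀ {x x′} → x S.≈ x′ → to x T.≈ to x′
      from-cong : ∀ {y y′} → y T.≈ y′ → from y S.≈ from y′
      P-resp    : ∀ {x x′} → x S.≈ x′ → P x ≡ P x′
      Q-resp    : ∀ {y y′} → y T.≈ y′ → Q y ≡ Q y′
      to-Q      : ∀ {x} → P x ≡ true → Q (to x) ≡ true
      from-P    : ∀ {y} → Q y ≡ true → P (from y) ≡ true
      from-to   : ∀ {x} → P x ≡ true → from (to x) S.≈ x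
      to-from   : ∀ {y} → Q y ≡ true → to (from y) T.≈ y

module RingSum {c ℓ : Level} (R : CommutativeRing c ℓ) where

  open CommutativeRing R hiding (zero) renaming (refl to ≈-refl; sym to ≈-sym; trans to ≈-trans)
  open import Relation.Binary.Reasoning.Setoid setoid
  open import Algebra.Properties.Ring ring using (-1*x≈-x; -‿involutive)

  open ListSum +-commutativeMonoid public
  open ListSum *-commutativeMonoid public using ()
    renaming (∑ to ∏; ∑-cong to ∏-cong; ∑-allFin-suc to ∏-allFin-suc; ∑-fibres to ∏-fibres)

  ind : Bool → Carrier
  ind b = if b then 1# else 0#

  ind-∧ : ∀ a b → ind (a ∧ b) ≈ ind a * ind b
  ind-∧ true  b = ≈-sym (*-identityˡ _)
  ind-∧ false b = ≈-sym (zeroˡ _)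

  ind-*≈if : ∀ b x → ind b * x ≈ (if b then x else 0#)
  ind-*≈if true  x = *-identityˡ x
  ind-*≈if false x = zeroˡ x

  ind-split : ∀ b c → ind b ≈ ind (b ∧ not c) + ind (b ∧ c)
  ind-split false _     = ≈-sym (+-identityˡ 0#)
  ind-split true  true  = ≈-sym (+-identityˡ 1#)
  ind-split true  false = ≈-sym (+-identityʳ 1#)

  ∑-split : ∀ {a} {A : Set a} {i i₁ i₂ f : A → Carrier} xs → (∀ y → i y ≈ i₁ y + i₂ y) →
            ∑ (λ y → i y * f y) xs ≈ ∑ (λ y → i₁ y * f y) xs + ∑ (λ y → i₂ y * f y) xs
  ∑-split xs i≈ = ≈-trans (∑-cong xs (λ y → ≈-trans (*-congʳ (i≈ y)) (distribʳ _ _ _))) (∑-distrib _ _ xs)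

  x≈y+z⇒y≈x-z : ∀ {u v z} → u ≈ v + z → v ≈ u + - z
  x≈y+z⇒y≈x-z {u} {v} {z} u≈v+z = begin
    v                 ≈⟨ +-identityʳ v ⟨
    v + 0#            ≈⟨ +-congˡ (-‿inverseʳ z) ⟨
    v + (z + - z)     ≈⟨ +-assoc v z (- z) ⟨
    (v + z) + - z     ≈⟨ +-congʳ u≈v+z ⟨
    u + - z           ∎

  module _ {a : Level} {A : Set a} where

    ∑-*ˡ : ∀ k (f : A → Carrier) xs → k * ∑ f xs ≈ ∑ (λ x → k * f x) xs
    ∑-*ˡ k f []       = zeroʳ k
    ∑-*ˡ k f (x ∷ xs) = ≈-trans (distribˡ k _ _) (+-congˡ (∑-*ˡ k f xs))

    ∑-*ʳ : ∀ k (f : A → Carrier) xs → ∑ f xs * k ≈ ∑ (λ x → f x * k) xs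
    ∑-*ʳ k f xs = ≈-trans (*-comm _ _) (≈-trans (∑-*ˡ k f xs) (∑-cong xs (λ x → *-comm k (f x))))

    ∑-filterᵇ-ind : ∀ (p : A → Bool) (f : A → Carrier) xs → ∑ f (filterᵇ p xs) ≈ ∑ (λ x → ind (p x) * f x) xs
    ∑-filterᵇ-ind p f xs = ≈-trans (∑-filterᵇ p f xs) (∑-cong xs (λ x → ≈-sym (ind-*≈if (p x) (f x))))

    pow-sumℕ : ∀ a (f : A → ℕ) xs → pow R a (sumℕ (map f xs)) ≈ ∏ (pow R a ∘ f) xs
    pow-sumℕ a f []       = ≈-refl
    pow-sumℕ a f (x ∷ xs) = ≈-trans (pow-+ (f x) _) (*-congˡ (pow-sumℕ a f xs))
      where
      pow-+ : ∀ m k → pow R a (m ℕ.+ k) ≈ pow R a m * pow R a k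
      pow-+ zero    k = ≈-sym (*-identityˡ _)
      pow-+ (suc m) k = ≈-trans (*-congˡ (pow-+ m k)) (≈-sym (*-assoc _ _ _))

  sgn-sq : ∀ m → sgn R m * sgn R m ≈ 1#
  sgn-sq zero    = *-identityˡ 1#
  sgn-sq (suc m) = begin
    (- 1# * sgn R m) * (- 1# * sgn R m) ≈⟨ *-assoc _ _ _ ⟩
    - 1# * (sgn R m * (- 1# * sgn R m)) ≈⟨ *-congˡ (≈-trans (≈-sym (*-assoc _ _ _)) (*-congʳ (*-comm _ _))) ⟩
    - 1# * ((- 1# * sgn R m) * sgn R m) ≈⟨ *-congˡ (*-assoc _ _ _) ⟩
    - 1# * (- 1# * (sgn R m * sgn R m)) ≈⟨ ≈-sym (*-assoc _ _ _) ⟩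
    (- 1# * - 1#) * (sgn R m * sgn R m) ≈⟨ *-cong (≈-trans (-1*x≈-x _) (-‿involutive _)) (sgn-sq m) ⟩
    1# * 1#                             ≈⟨ *-identityˡ 1# ⟩
    1#                                  ∎

  ∑-funs-∏ : ∀ {b} {B : Set b} m (h : Fin m → B → Carrier) (xs : List B) →
             ∑ (λ κ → ∏ (λ v → h v (κ v)) (allFin m)) (funs m xs) ≈ ∏ (λ v → ∑ (h v) xs) (allFin m)
  ∑-funs-∏ zero    h xs = +-identityʳ 1#
  ∑-funs-∏ (suc m) h xs = begin
    ∑ (λ κ → ∏ (λ v → h v (κ v)) (allFin (suc m))) (funs (suc m) xs)
      ≈⟨ ∑-funs-suc m xs _ (λ f≗g → ∏-cong (allFin (suc m)) (λ v → reflexive (cong (h v) (f≗g v)))) ⟩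
    ∑ (λ y → ∑ (λ g → ∏ (λ v → h v ((y Vector.∷ g) v)) (allFin (suc m))) (funs m xs)) xs
      ≈⟨ ∑-cong xs (λ y → ∑-cong (funs m xs) (λ g → reflexive (∏-allFin-suc (λ v → h v ((y Vector.∷ g) v))))) ⟩
    ∑ (λ y → ∑ (λ g → h zero y * ∏ (λ v → h (suc v) (g v)) (allFin m)) (funs m xs)) xs
      ≈⟨ ∑-cong xs (λ y → ≈-trans (≈-sym (∑-*ˡ (h zero y) _ (funs m xs))) (*-congˡ (∑-funs-∏ m (h ∘ suc) xs))) ⟩
    ∑ (λ y → h zero y * ∏ (λ v → ∑ (h (suc v)) xs) (allFin m)) xs
      ≈⟨ ∑-*ʳ _ (h zero) xs ⟨
    ∑ (h zero) xs * ∏ (λ v → ∑ (h (suc v)) xs) (allFin m)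
      ≡⟨ ∏-allFin-suc (λ v → ∑ (h v) xs) ⟨
    ∏ (λ v → ∑ (h v) xs) (allFin (suc m)) ∎

  Enumerates : ∀ {a ℓ′} (S : DecSetoid a ℓ′) → List (DecSetoid.Carrier S) → Set (a ⊔ ℓ)
  Enumerates S xs = ∀ x → ∑ (λ y → ind (does (x S.≟ y))) xs ≈ 1#
    where module S = DecSetoid S

  module _ {a ℓ′ : Level} (S : DecSetoid a ℓ′) where

    private
      module S = DecSetoid S

    ∑-δ : ∀ xs → Enumerates S xs → ∀ {F : S.Carrier → Carrier} → (∀ {y z} → y S.≈ z → F y ≈ F z) →
          ∀ x → ∑ (λ y → ind (does (x S.≟ y)) * F y) xs ≈ F x
    ∑-δ xs enum {F} F-resp x = begin
      ∑ (λ y → ind (does (x S.≟ y)) * F y) xs ≈⟨ ∑-cong xs at-x ⟩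
      ∑ (λ y → ind (does (x S.≟ y)) * F x) xs ≈⟨ ≈-sym (∑-*ʳ (F x) _ xs) ⟩
      ∑ (λ y → ind (does (x S.≟ y))) xs * F x ≈⟨ *-congʳ (enum x) ⟩
      1# * F x                                ≈⟨ *-identityˡ (F x) ⟩
      F x                                     ∎
      where
      at-x : ∀ y → ind (does (x S.≟ y)) * F y ≈ ind (does (x S.≟ y)) * F x
      at-x y with x S.≟ y
      ... | yes x≈y = *-congˡ (F-resp (S.sym x≈y))
      ... | no  _   = ≈-trans (zeroˡ _) (≈-sym (zeroˡ _))

    funs-enumerates : ∀ {xs} → Enumerates S xs → ∀ n → Enumerates (Pointwise.decSetoid S n) (funs n xs)
    funs-enumerates enum zero    f = +-identityʳ 1#
    funs-enumerates {xs} enum (suc n) f = begin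
      ∑ (λ g → ind (does (f S¹⁺ⁿ.≟ g))) (funs (suc n) xs)
        ≈⟨ ∑-funs-suc n xs _ (λ {g} {g′} g≗g′ → reflexive (cong ind (does-⇔ (≗-⇔ g≗g′) (f S¹⁺ⁿ.≟ g) (f S¹⁺ⁿ.≟ g′)))) ⟩
      ∑ (λ y → ∑ (λ g → ind (does (f S¹⁺ⁿ.≟ (y Vector.∷ g)))) (funs n xs)) xs
        ≈⟨ ∑-cong xs (λ y → ∑-cong (funs n xs) (λ g → ind-∧ (does (f zero S.≟ y)) (does ((f ∘ suc) Sⁿ.≟ g)))) ⟩
      ∑ (λ y → ∑ (λ g → ind (does (f zero S.≟ y)) * ind (does ((f ∘ suc) Sⁿ.≟ g))) (funs n xs)) xs
        ≈⟨ ∑-cong xs (λ y → ≈-trans (≈-sym (∑-*ˡ _ _ (funs n xs))) (≈-trans (*-congˡ (funs-enumerates enum n (f ∘ suc))) (*-identityʳ _))) ⟩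
      ∑ (λ y → ind (does (f zero S.≟ y))) xs
        ≈⟨ enum (f zero) ⟩
      1# ∎
      where
      module Sⁿ = DecSetoid (Pointwise.decSetoid S n)
      module S¹⁺ⁿ = DecSetoid (Pointwise.decSetoid S (suc n))
      ≗-⇔ : ∀ {g g′} → (∀ i → g i ≡ g′ i) → f S¹⁺ⁿ.≈ g ⇔ f S¹⁺ⁿ.≈ g′
      ≗-⇔ g≗g′ = mk⇔ (λ f≈g i → subst (f i S.≈_) (g≗g′ i) (f≈g i)) (λ f≈g′ i → subst (f i S.≈_) (sym (g≗g′ i)) (f≈g′ i))

  allFin-enumerates : ∀ N → Enumerates (Fin.≡-decSetoid N) (allFin N)
  allFin-enumerates N i =
    ≈-trans (∑-single i _ (λ j j≢i → reflexive (cong ind (dec-false (i Fin.≟ j) (j≢i ∘ sym)))))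
          (reflexive (cong ind (dec-true (i Fin.≟ i) refl)))

  bools-enumerates : Enumerates Bool.≡-decSetoid bools
  bools-enumerates true  = ≈-trans (+-congˡ (+-identityʳ 0#)) (+-identityʳ 1#)
  bools-enumerates false = ≈-trans (+-identityˡ _) (+-identityʳ 1#)

  module _ {a₁ ℓ₁ a₂ ℓ₂ : Level} {S : DecSetoid a₁ ℓ₁} {T : DecSetoid a₂ ℓ₂}
           {P : DecSetoid.Carrier S → Bool} {Q : DecSetoid.Carrier T → Bool} (b : SubsetBijection S T P Q) where

    private
      module S = DecSetoid S
      module T = DecSetoid T
    open SubsetBijection b

    private
      selected : ∀ {p q : Bool} {x} → p ≡ true → q ≡ true → (ind p * x) * ind q ≈ x
      selected refl refl = ≈-trans (*-identityʳ _) (*-identityˡ _)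

      unselectedˡ : ∀ {p : Bool} q {x} → p ≡ false → (ind p * x) * ind q ≈ 0#
      unselectedˡ q refl = ≈-trans (*-congʳ (zeroˡ _)) (zeroˡ _)

    -- Double counting of the pairs (x , y) with P x and to x ≈ y, equivalently Q y and from y ≈ x.
    ∑-bijection : ∀ xs ys → Enumerates S xs → Enumerates T ys →
                  ∀ {F : S.Carrier → Carrier} {H : T.Carrier → Carrier} →
                  (∀ {y y′} → y T.≈ y′ → H y ≈ H y′) → (∀ {x} → P x ≡ true → F x ≈ H (to x)) →
                  ∑ (λ x → ind (P x) * F x) xs ≈ ∑ (λ y → ind (Q y) * H y) ys
    ∑-bijection xs ys enumS enumT {F} {H} H-resp F≈H = begin
      ∑ (λ x → ind (P x) * F x) xs
        ≈⟨ ∑-cong xs (λ x → ≈-trans (≈-sym (*-identityʳ _)) (*-congˡ (≈-sym (enumT (to x))))) ⟩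
      ∑ (λ x → (ind (P x) * F x) * ∑ (λ y → ind (does (to x T.≟ y))) ys) xs
        ≈⟨ ∑-cong xs (λ x → ∑-*ˡ _ _ ys) ⟩
      ∑ (λ x → ∑ (λ y → (ind (P x) * F x) * ind (does (to x T.≟ y))) ys) xs
        ≈⟨ ∑-cong xs (λ x → ∑-cong ys (pair x)) ⟩
      ∑ (λ x → ∑ (λ y → (ind (Q y) * H y) * ind (does (from y S.≟ x))) ys) xs
        ≈⟨ ∑-comm _ xs ys ⟩
      ∑ (λ y → ∑ (λ x → (ind (Q y) * H y) * ind (does (from y S.≟ x))) xs) ys
        ≈⟨ ∑-cong ys (λ y → ≈-sym (∑-*ˡ _ _ xs)) ⟩
      ∑ (λ y → (ind (Q y) * H y) * ∑ (λ x → ind (does (from y S.≟ x))) xs) ys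
        ≈⟨ ∑-cong ys (λ y → ≈-trans (*-congˡ (enumS (from y))) (*-identityʳ _)) ⟩
      ∑ (λ y → ind (Q y) * H y) ys ∎
      where
      no-partner : ∀ {x y} → ¬ (P x ≡ true × to x T.≈ y) → (ind (Q y) * H y) * ind (does (from y S.≟ x)) ≈ 0#
      no-partner {x} {y} ¬matched with Q y in qy | from y S.≟ x
      ... | true  | yes fy≈x = ⊥-elim (¬matched ( trans (sym (P-resp fy≈x)) (from-P qy)
                                                , T.trans (to-cong (S.sym fy≈x)) (to-from qy)))
      ... | true  | no  _    = zeroʳ _
      ... | false | _        = unselectedˡ _ refl
      pair : ∀ x y → (ind (P x) * F x) * ind (does (to x T.≟ y)) ≈ (ind (Q y) * H y) * ind (does (from y S.≟ x))
      pair x y with P x in px | to x T.≟ y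
      ... | true  | yes tx≈y = begin
        (1# * F x) * 1#  ≈⟨ selected refl refl ⟩
        F x              ≈⟨ F≈H px ⟩
        H (to x)         ≈⟨ H-resp tx≈y ⟩
        H y              ≈⟨ ≈-sym (selected (trans (sym (Q-resp tx≈y)) (to-Q px))
                                          (dec-true (from y S.≟ x) (S.trans (from-cong (T.sym tx≈y)) (from-to px)))) ⟩
        (ind (Q y) * H y) * ind (does (from y S.≟ x)) ∎
      ... | true  | no ¬tx≈y = ≈-trans (zeroʳ _) (≈-sym (no-partner (¬tx≈y ∘ proj₂)))
      ... | false | _        = ≈-trans (unselectedˡ _ refl) (≈-sym (no-partner (λ matched → Bool.not-¬ (proj₁ matched) px)))

record FirstEdge (n : ℕ) : Set where
  field
    G                : WGraph (suc n)
    a w              : Fin (suc n)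
    edge             : adj G a w ≡ true
    isolated-below-a : ∀ {v} u → v < a → adj G v u ≡ false

module Contraction {n : ℕ} (E : FirstEdge n) where

  open FirstEdge E public

  a≢w : a ≢ w
  a≢w refl = not-¬ edge (adj-irrefl G a)

  σ : Fin n → Fin (suc n)
  σ = punchIn w

  α : Fin n
  α = punchOut (a≢w ∘ sym)

  -- Collapses w onto a, renumbering the other vertices.
  π : Fin (suc n) → Fin n
  π u with w Fin.≟ u
  ... | yes _   = α
  ... | no  w≢u = punchOut w≢u

  π-σ : ∀ i → π (σ i) ≡ i
  π-σ i with w Fin.≟ σ i
  ... | yes w≡σi = ⊥-elim (Fin.punchInᵢ≢i w i (sym w≡σi))
  ... | no  _    = trans (Fin.punchOut-cong w refl) (Fin.punchOut-punchIn w)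

  σ-π : ∀ {u} → u ≢ w → σ (π u) ≡ u
  σ-π {u} u≢w with w Fin.≟ u
  ... | yes w≡u = ⊥-elim (u≢w (sym w≡u))
  ... | no  w≢u = Fin.punchIn-punchOut w≢u

  π-w : π w ≡ α
  π-w with w Fin.≟ w
  ... | yes _   = refl
  ... | no  w≢w = ⊥-elim (w≢w refl)

  π-a : π a ≡ α
  π-a with w Fin.≟ a
  ... | yes w≡a = ⊥-elim (a≢w (sym w≡a))
  ... | no  _   = Fin.punchOut-cong w refl

  σ-α : σ α ≡ a
  σ-α = Fin.punchIn-punchOut _

  σ-injective : ∀ {i j} → σ i ≡ σ j → i ≡ j
  σ-injective = Fin.punchIn-injective w _ _

  π-fibre : ∀ {u s} → π u ≡ s → u ≡ σ s ⊎ (u ≡ w × s ≡ α)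
  π-fibre {u} refl with u Fin.≟ w
  ... | yes refl = inj₂ (refl , π-w)
  ... | no  u≢w  = inj₁ (sym (σ-π u≢w))

  π-fibre-α : ∀ {u} → π u ≡ α → u ≡ a ⊎ u ≡ w
  π-fibre-α πu≡α with π-fibre πu≡α
  ... | inj₁ u≡σα    = inj₁ (trans u≡σα σ-α)
  ... | inj₂ (u≡w , _) = inj₂ u≡w

  π-fibre-≢α : ∀ {u s} → π u ≡ s → s ≢ α → u ≡ σ s
  π-fibre-≢α πu≡s s≢α with π-fibre πu≡s
  ... | inj₁ u≡σs     = u≡σs
  ... | inj₂ (_ , s≡α) = ⊥-elim (s≢α s≡α)

  α≤π : ∀ {u} → a ≤ u → α ≤ π u
  α≤π {u} a≤u with w Fin.≟ u
  ... | yes _   = Fin.≤-refl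
  ... | no  w≢u = Fin.punchOut-mono-≤ (a≢w ∘ sym) w≢u a≤u

  onEdge : Fin (suc n) → Fin (suc n) → Bool
  onEdge u v = ((u == a) ∧ (v == w)) ∨ ((u == w) ∧ (v == a))

  onEdge-sym : ∀ u v → onEdge u v ≡ onEdge v u
  onEdge-sym u v = trans (∨-comm ((u == a) ∧ (v == w)) _) (cong₂ _∨_ (∧-comm (u == w) (v == a)) (∧-comm (u == a) (v == w)))

  onEdge-sound : ∀ {u v} → onEdge u v ≡ true → (u ≡ a × v ≡ w) ⊎ (u ≡ w × v ≡ a)
  onEdge-sound {u} {v} h with ∨-elim ((u == a) ∧ (v == w)) h
  ... | inj₁ h′ = inj₁ (==-sound _ _ (∧-elimˡ _ h′) , ==-sound _ _ (∧-elimʳ (u == a) h′))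
  ... | inj₂ h′ = inj₂ (==-sound _ _ (∧-elimˡ _ h′) , ==-sound _ _ (∧-elimʳ (u == w) h′))

  onEdge-aw : onEdge a w ≡ true
  onEdge-aw = ∨-introˡ _ (∧-intro (==-refl a) (==-refl w))

  onEdge-wa : onEdge w a ≡ true
  onEdge-wa = trans (onEdge-sym w a) onEdge-aw

  delete : Digraph (suc n) → Digraph (suc n)
  delete o u v = o u v ∧ not (onEdge u v)

  delete-⊆ : ∀ o {u v} → delete o u v ≡ true → o u v ≡ true
  delete-⊆ o {u} {v} = ∧-elimˡ (o u v)

  delete-onEdge : ∀ o {u v} → onEdge u v ≡ true → delete o u v ≡ false
  delete-onEdge o {u} {v} e = trans (cong (λ b → o u v ∧ not b) e) (∧-zeroʳ (o u v))

  delete-offEdge : ∀ o {u v} → onEdge u v ≡ false → delete o u v ≡ o u v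
  delete-offEdge o {u} {v} e = trans (cong (λ b → o u v ∧ not b) e) (∧-identityʳ (o u v))

  onEdge-adj : ∀ {u v} → onEdge u v ≡ true → adj G u v ≡ true
  onEdge-adj {u} {v} uv with onEdge-sound {u} {v} uv
  ... | inj₁ (refl , refl) = edge
  ... | inj₂ (refl , refl) = trans (adj-sym G w a) edge

  same-edge : ∀ {p q u v} → onEdge p q ≡ true → onEdge u v ≡ true → (u ≡ p × v ≡ q) ⊎ (u ≡ q × v ≡ p)
  same-edge {p} {q} {u} {v} pq uv with onEdge-sound {p} {q} pq | onEdge-sound {u} {v} uv
  ... | inj₁ (refl , refl) | inj₁ (refl , refl) = inj₁ (refl , refl)
  ... | inj₁ (refl , refl) | inj₂ (refl , refl) = inj₂ (refl , refl)
  ... | inj₂ (refl , refl) | inj₁ (refl , refl) = inj₂ (refl , refl)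
  ... | inj₂ (refl , refl) | inj₂ (refl , refl) = inj₁ (refl , refl)

  onEdge? : ∀ u v → onEdge u v ≡ false ⊎ onEdge u v ≡ true
  onEdge? u v with onEdge u v
  ... | false = inj₁ refl
  ... | true  = inj₂ refl

  onEdge-≢ : ∀ {p q} → onEdge p q ≡ true → p ≢ q
  onEdge-≢ {p} {q} pq p≡q with onEdge-sound {p} {q} pq
  ... | inj₁ (refl , refl) = a≢w p≡q
  ... | inj₂ (refl , refl) = a≢w (sym p≡q)

  delete-≐ : ∀ {o o′} → o ≐ o′ → delete o ≐ delete o′
  delete-≐ o≐o′ u v = cong (_∧ not (onEdge u v)) (o≐o′ u v)

  delete-acyclic : ∀ {γ} → Acyclic γ → Acyclic (delete γ)
  delete-acyclic {γ} acyclic i = acyclic i ∘ mapWalk (delete-⊆ γ)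

  G∖e : WGraph (suc n)
  G∖e = record
    { adj        = delete (adj G)
    ; adj-sym    = λ i j → cong₂ (λ x y → x ∧ not y) (adj-sym G i j) (onEdge-sym i j)
    ; adj-irrefl = λ i → cong (_∧ not (onEdge i i)) (adj-irrefl G i)
    ; weight     = weight G
    ; weight-pos = weight-pos G
    }

  contract : Digraph (suc n) → Digraph n
  contract M i j = anyB λ u → anyB λ v → ((π u == i) ∧ (π v == j)) ∧ M u v

  contract-sound : ∀ {M i j} → contract M i j ≡ true → ∃₂ λ u v → π u ≡ i × π v ≡ j × M u v ≡ true
  contract-sound {M} {i} {j} h with anyB-elim _ h
  ... | u , h′ with anyB-elim _ h′
  ...   | v , h″ = u , v , ==-sound _ _ (∧-elimˡ _ (∧-elimˡ _ h″)) , ==-sound _ _ (∧-elimʳ (π u == i) (∧-elimˡ _ h″))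
                 , ∧-elimʳ ((π u == i) ∧ (π v == j)) h″

  contract-complete : ∀ {M u v i j} → π u ≡ i → π v ≡ j → M u v ≡ true → contract M i j ≡ true
  contract-complete {u = u} {v} πu≡i πv≡j h =
    anyB-intro _ u (anyB-intro _ v (∧-intro (∧-intro (==-complete πu≡i) (==-complete πv≡j)) h))

  contract-mono : ∀ {M M′} → (∀ {u v} → M u v ≡ true → M′ u v ≡ true) →
                  ∀ {i j} → contract M i j ≡ true → contract M′ i j ≡ true
  contract-mono M⊆M′ h =
    let u , v , πu≡i , πv≡j , Muv = contract-sound h in contract-complete πu≡i πv≡j (M⊆M′ Muv)

  contract-≐ : ∀ {M M′} → M ≐ M′ → contract M ≐ contract M′
  contract-≐ M≐M′ i j = true-⇔⇒≡ (contract-mono (λ {u} {v} h → trans (sym (M≐M′ u v)) h))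
                                 (contract-mono (λ {u} {v} h → trans (M≐M′ u v) h))

  lift : Digraph n → Digraph (suc n)
  lift δ u v = adj G∖e u v ∧ δ (π u) (π v)

  lift-≐ : ∀ {δ δ′} → δ ≐ δ′ → lift δ ≐ lift δ′
  lift-≐ δ≐δ′ u v = cong (adj G∖e u v ∧_) (δ≐δ′ (π u) (π v))

  no-edge-in-α : ∀ {u v} → π u ≡ α → π v ≡ α → adj G∖e u v ≡ false
  no-edge-in-α πu≡α πv≡α with π-fibre-α πu≡α | π-fibre-α πv≡α
  ... | inj₁ refl | inj₁ refl = adj-irrefl G∖e a
  ... | inj₁ refl | inj₂ refl = delete-onEdge (adj G) onEdge-aw
  ... | inj₂ refl | inj₁ refl = delete-onEdge (adj G) onEdge-wa
  ... | inj₂ refl | inj₂ refl = adj-irrefl G∖e w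

  fibre : Fin n → List (Fin (suc n))
  fibre i = filterᵇ (λ u → π u == i) (allFin (suc n))

  fibre-weight : ∀ i → weight G (σ i) ℕ.≤ sumℕ (map (weight G) (fibre i))
  fibre-weight i = begin
    weight G (σ i)                                     ≡⟨ cong (if_then weight G (σ i) else 0) (sym (==-complete (π-σ i))) ⟩
    g (σ i)                                            ≤⟨ ℕ.m≤m+n _ _ ⟩
    g (σ i) ℕ.+ ℕsum.∑ (g ∘ punchIn (σ i)) (allFin n)  ≡⟨ ℕsum.∑-punchIn (σ i) g ⟨
    ℕsum.∑ g (allFin (suc n))                          ≡⟨ ℕsum.∑-filterᵇ _ (weight G) (allFin (suc n)) ⟨
    sumℕ (map (weight G) (fibre i))                    ∎
    where
    open ℕ.≤-Reasoning
    g : Fin (suc n) → ℕ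
    g u = if π u == i then weight G u else 0

  -- Every vertex carries the total weight of its fibre, so α weighs w(a) + w(w).
  G/e : WGraph n
  G/e = record
    { adj        = contract (adj G∖e)
    ; adj-sym    = λ i j → true-⇔⇒≡ (flip′ i j) (flip′ j i)
    ; adj-irrefl = λ i → ¬-not (irrefl i)
    ; weight     = λ i → sumℕ (map (weight G) (fibre i))
    ; weight-pos = λ i → ℕ.≤-trans (weight-pos G (σ i)) (fibre-weight i)
    }
    where
    flip′ : ∀ i j → contract (adj G∖e) i j ≡ true → contract (adj G∖e) j i ≡ true
    flip′ i j h =
      let u , v , πu≡i , πv≡j , e = contract-sound h in contract-complete πv≡j πu≡i (trans (adj-sym G∖e v u) e)
    loop : ∀ {u v i} → π u ≡ i → π v ≡ i → adj G∖e u v ≢ true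
    loop {i = i} πu≡i πv≡i e with π-fibre πu≡i | π-fibre πv≡i
    ... | inj₁ refl         | inj₁ refl         = not-¬ e (adj-irrefl G∖e (σ i))
    ... | inj₂ (refl , i≡α) | _                 = not-¬ e (no-edge-in-α π-w (trans πv≡i i≡α))
    ... | inj₁ refl         | inj₂ (refl , i≡α) = not-¬ e (no-edge-in-α (trans πu≡i i≡α) π-w)
    irrefl : ∀ i → contract (adj G∖e) i i ≢ true
    irrefl i h = let u , v , πu≡i , πv≡i , e = contract-sound h in loop πu≡i πv≡i e

  fibres-weight : ∀ (p : Fin n → Bool) →
    sumℕ (map (weight G/e) (filterᵇ p (allFin n))) ≡ sumℕ (map (weight G) (filterᵇ (p ∘ π) (allFin (suc n))))
  fibres-weight p = begin
    sumℕ (map (weight G/e) (filterᵇ p (allFin n)))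
      ≡⟨ ℕsum.∑-filterᵇ p (weight G/e) (allFin n) ⟩
    ℕsum.∑ (λ i → if p i then ℕsum.∑ (weight G) (fibre i) else 0) (allFin n)
      ≡⟨ ℕsum.∑-cong (allFin n) (λ i → if-∑ (p i) (fibre i)) ⟩
    ℕsum.∑ (λ i → ℕsum.∑ (λ u → if p i then weight G u else 0) (fibre i)) (allFin n)
      ≡⟨ ℕsum.∑-fibres π (λ i u → if p i then weight G u else 0) ⟩
    ℕsum.∑ (λ u → if p (π u) then weight G u else 0) (allFin (suc n))
      ≡⟨ ℕsum.∑-filterᵇ (p ∘ π) (weight G) (allFin (suc n)) ⟨
    sumℕ (map (weight G) (filterᵇ (p ∘ π) (allFin (suc n)))) ∎
    where
    open ≡-Reasoning
    if-∑ : ∀ b us → (if b then ℕsum.∑ (weight G) us else 0) ≡ ℕsum.∑ (λ u → if b then weight G u else 0) us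
    if-∑ true  us = refl
    if-∑ false us = sym (ℕsum.∑-ε us (λ _ → refl))

  project-walk : ∀ {o : Digraph (suc n)} {δ : Digraph n} → (∀ {u v} → o u v ≡ true → δ (π u) (π v) ≡ true) →
                 ∀ {u v} → Walk o u v → Walk δ (π u) (π v)
  project-walk f (arc h)  = arc (f h)
  project-walk f (h ◅ W) = f h ◅ project-walk f W

  project-walk-a→w : ∀ {o : Digraph (suc n)} {δ : Digraph n} →
                     (∀ {u v} → o u v ≡ true → (u ≡ a × v ≡ w) ⊎ δ (π u) (π v) ≡ true) →
                     ∀ {u v} → Walk o u v → Walk δ (π u) (π v) ⊎ (u ≡ a × v ≡ w)
  project-walk-a→w hyp (arc h) with hyp h
  ... | inj₁ u≡a×v≡w = inj₂ u≡a×v≡w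
  ... | inj₂ r       = inj₁ (arc r)
  project-walk-a→w {δ = δ} hyp {u} {v} (h ◅ W) with hyp h | project-walk-a→w hyp W
  ... | inj₁ (refl , refl) | inj₁ W′         = inj₁ (subst (λ z → Walk δ z (π v)) (trans π-w (sym π-a)) W′)
  ... | inj₁ (refl , refl) | inj₂ (w≡a , _) = ⊥-elim (a≢w (sym w≡a))
  ... | inj₂ r             | inj₁ W′         = inj₁ (r ◅ W′)
  ... | inj₂ r             | inj₂ (refl , refl) = inj₁ (arc (subst (λ z → δ (π u) z ≡ true) (trans π-a (sym π-w)) r))

  project-reach-a→w : ∀ {o : Digraph (suc n)} {δ : Digraph n} →
                      (∀ {u v} → o u v ≡ true → (u ≡ a × v ≡ w) ⊎ δ (π u) (π v) ≡ true) →
                      ∀ {u v} → Reach o u v → Reach δ (π u) (π v)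
  project-reach-a→w hyp (inj₁ refl) = inj₁ refl
  project-reach-a→w hyp (inj₂ W) with project-walk-a→w hyp W
  ... | inj₁ W′          = inj₂ W′
  ... | inj₂ (refl , refl) = inj₁ (trans π-a (sym π-w))

  module _ {γ′ γ : Digraph (suc n)} (γ′⊆γ : ∀ {u v} → γ′ u v ≡ true → γ u v ≡ true) (a→w : γ a w ≡ true) where

    private
      lift-arc : ∀ {u v s i} → π u ≡ s → π v ≡ i → γ′ u v ≡ true → γ (σ s) (σ i) ≡ true ⊎ Reach γ a (σ i)
      lift-arc πu≡s πv≡i e with π-fibre πv≡i
      ... | inj₂ (_ , refl) = inj₂ (inj₁ (sym σ-α))
      ... | inj₁ refl with π-fibre πu≡s
      ...   | inj₁ refl       = inj₁ (γ′⊆γ e)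
      ...   | inj₂ (refl , _) = inj₂ (inj₂ (a→w ◅ arc (γ′⊆γ e)))

    lift-walk : ∀ {s i} → Walk (contract γ′) s i → Walk γ (σ s) (σ i) ⊎ Reach γ a (σ i)
    lift-walk (arc h) =
      let _ , _ , πu≡s , πv≡i , e = contract-sound h in Sum.map₁ arc (lift-arc πu≡s πv≡i e)
    lift-walk (h ◅ W) with lift-walk W
    ... | inj₂ a⇝i = inj₂ a⇝i
    ... | inj₁ W′ =
      let _ , _ , πu≡s , πv≡k , e = contract-sound h in
      [ (λ e′ → inj₁ (e′ ◅ W′)) , (λ a⇝k → inj₂ (Reach-trans a⇝k (inj₂ W′))) ]′ (lift-arc πu≡s πv≡k e)

  module _ (γ′ : Digraph (suc n)) where

    IntoFibreα : Fin n → Set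
    IntoFibreα s = s ≡ α ⊎ ∃ λ y → π y ≡ α × Walk γ′ (σ s) y

    OutOfFibreα : Fin n → Set
    OutOfFibreα i = i ≡ α ⊎ ∃ λ x → π x ≡ α × Walk γ′ x (σ i)

    ContractedWalk : Fin n → Fin n → Set
    ContractedWalk s i = (s ≢ α × i ≢ α × Walk γ′ (σ s) (σ i)) ⊎ (IntoFibreα s × OutOfFibreα i)

    private
      arc-≢α : ∀ {u v s k} → π u ≡ s → π v ≡ k → s ≢ α → k ≢ α → γ′ u v ≡ true → γ′ (σ s) (σ k) ≡ true
      arc-≢α πu≡s πv≡k s≢α k≢α = subst₂ (λ x y → γ′ x y ≡ true) (π-fibre-≢α πu≡s s≢α) (π-fibre-≢α πv≡k k≢α)

      from-≢α : ∀ {u v s} → π u ≡ s → s ≢ α → γ′ u v ≡ true → γ′ (σ s) v ≡ true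
      from-≢α πu≡s s≢α = subst (λ x → γ′ x _ ≡ true) (π-fibre-≢α πu≡s s≢α)

      into-≢α : ∀ {u v k} → π v ≡ k → k ≢ α → γ′ u v ≡ true → γ′ u (σ k) ≡ true
      into-≢α πv≡k k≢α = subst (λ y → γ′ _ y ≡ true) (π-fibre-≢α πv≡k k≢α)

      single : ∀ {u v s i} → π u ≡ s → π v ≡ i → γ′ u v ≡ true → ContractedWalk s i
      single {u} {v} {s} {i} πu≡s πv≡i e with s Fin.≟ α | i Fin.≟ α
      ... | yes s≡α | yes i≡α = inj₂ (inj₁ s≡α , inj₁ i≡α)
      ... | yes s≡α | no  i≢α = inj₂ (inj₁ s≡α , inj₂ (u , trans πu≡s s≡α , arc (into-≢α πv≡i i≢α e)))
      ... | no  s≢α | yes i≡α = inj₂ (inj₂ (v , trans πv≡i i≡α , arc (from-≢α πu≡s s≢α e)) , inj₁ i≡α)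
      ... | no  s≢α | no  i≢α = inj₁ (s≢α , i≢α , arc (arc-≢α πu≡s πv≡i s≢α i≢α e))

      step : ∀ {u v s k i} → π u ≡ s → π v ≡ k → γ′ u v ≡ true → ContractedWalk k i → ContractedWalk s i
      step {u} {s = s} πu≡s πv≡k e (inj₁ (k≢α , i≢α , W)) with s Fin.≟ α
      ... | yes s≡α = inj₂ (inj₁ s≡α , inj₂ (u , trans πu≡s s≡α , into-≢α πv≡k k≢α e ◅ W))
      ... | no  s≢α = inj₁ (s≢α , i≢α , arc-≢α πu≡s πv≡k s≢α k≢α e ◅ W)
      step {u} {v} {s} {k} πu≡s πv≡k e (inj₂ (into , out)) with s Fin.≟ α
      ... | yes s≡α = inj₂ (inj₁ s≡α , out)
      ... | no  s≢α = inj₂ (extend into , out)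
        where
        e′ : γ′ (σ s) v ≡ true
        e′ = from-≢α πu≡s s≢α e
        extend : IntoFibreα k → IntoFibreα s
        extend (inj₁ k≡α) = inj₂ (v , trans πv≡k k≡α , arc e′)
        extend (inj₂ (y , πy≡α , W)) with k Fin.≟ α
        ... | yes k≡α = inj₂ (v , trans πv≡k k≡α , arc e′)
        ... | no  k≢α = inj₂ (y , πy≡α , into-≢α πv≡k k≢α e′ ◅ W)

    contract-walk : ∀ {s i} → Walk (contract γ′) s i → ContractedWalk s i
    contract-walk (arc h)  = let _ , _ , πu≡s , πv≡i , e = contract-sound h in single πu≡s πv≡i e
    contract-walk (h ◅ W) = let _ , _ , πu≡s , πv≡k , e = contract-sound h in step πu≡s πv≡k e (contract-walk W)

    contract-acyclic : Acyclic γ′ → (∀ {x y} → π x ≡ α → π y ≡ α → ¬ Walk γ′ x y) → Acyclic (contract γ′)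
    contract-acyclic acyclic no-return s W = cycle (contract-walk W) W
      where
      leave : ∀ {u v k} → π u ≡ α → π v ≡ k → γ′ u v ≡ true → ¬ ContractedWalk k α
      leave πu≡α πv≡k e (inj₁ (_ , α≢α , _))   = α≢α refl
      leave πu≡α πv≡k e (inj₂ (inj₁ k≡α , _)) = no-return πu≡α (trans πv≡k k≡α) (arc e)
      leave {k = k} πu≡α πv≡k e (inj₂ (inj₂ (y , πy≡α , W′) , _)) with k Fin.≟ α
      ... | yes k≡α = no-return πu≡α (trans πv≡k k≡α) (arc e)
      ... | no  k≢α = no-return πu≡α πy≡α (into-≢α πv≡k k≢α e ◅ W′)
      cycle-at-α : ¬ Walk (contract γ′) α α
      cycle-at-α (arc h)   = let _ , _ , πu≡α , πv≡α , e = contract-sound h in no-return πu≡α πv≡α (arc e)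
      cycle-at-α (h ◅ W′) = let _ , _ , πu≡α , πv≡k , e = contract-sound h in leave πu≡α πv≡k e (contract-walk W′)
      cycle : ∀ {s} → ContractedWalk s s → ¬ Walk (contract γ′) s s
      cycle (inj₁ (_ , _ , W′))                                  _ = acyclic _ W′
      cycle (inj₂ (inj₂ (y , πy≡α , Wy) , inj₂ (x , πx≡α , Wx))) _ = no-return πx≡α πy≡α (Wx ◅◅ Wy)
      cycle (inj₂ (inj₁ refl , _))                               W′ = cycle-at-α W′
      cycle (inj₂ (_ , inj₁ refl))                               W′ = cycle-at-α W′

module DeletionContraction {n : ℕ} (E : FirstEdge n) where

  open Contraction E

  ArcsIn : Digraph (suc n) → Set
  ArcsIn o = ∀ {s k} → o s k ≡ true → adj G s k ≡ true

  a≤nonisolated : ∀ {s k} → adj G s k ≡ true → a ≤ s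
  a≤nonisolated {s} {k} e = ℕ.≮⇒≥ (λ s<a → not-¬ e (isolated-below-a k s<a))

  a≤reached : ∀ {o} → ArcsIn o → ∀ {u} → Reach o a u → a ≤ u
  a≤reached arcs     (inj₁ refl) = Fin.≤-refl
  a≤reached arcs {u} (inj₂ W)    = let k , e = last-arc W in a≤nonisolated (trans (adj-sym G u k) (arcs e))

  -- a is the least non-isolated vertex, so it is the root of everything it reaches.
  root-from-a : ∀ {o} → ArcsIn o → ∀ {u} → Reach o a u → root o u ≡ a
  root-from-a {o} arcs {u} a⇝u = root-unique o a⇝u a-least
    where
    a-least : ∀ {s} → Reach o s u → a ≤ s
    a-least (inj₁ refl) = a≤reached arcs a⇝u
    a-least (inj₂ W)    = a≤nonisolated (arcs (proj₂ (first-arc W)))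

  delete-orientation : ∀ {γ} → Orientation G γ → Orientation G∖e (delete γ)
  delete-orientation {γ} O = record
    { arc⇒edge = λ {i} {j} h → ∧-intro (arc⇒edge (delete-⊆ γ h)) (∧-elimʳ (γ i j) h)
    ; edge⇒arc = λ {i} {j} h →
        Sum.map (λ γij → ∧-intro γij (∧-elimʳ (adj G i j) h))
                (λ γji → ∧-intro γji (trans (cong not (onEdge-sym j i)) (∧-elimʳ (adj G i j) h)))
                (edge⇒arc (delete-⊆ (adj G) h))
    ; antisym  = λ h₁ h₂ → antisym (delete-⊆ γ h₁) (delete-⊆ γ h₂)
    }
    where open Orientation O

  avoids-edge : ∀ {γ′} → Orientation G∖e γ′ → ∀ {u v} → onEdge u v ≡ true → γ′ u v ≡ false
  avoids-edge O {u} {v} uv = ¬-not λ h → not-¬ (∧-elimʳ (adj G u v) (Orientation.arc⇒edge O h)) (cong not uv)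

  add-orientation : ∀ {p q} → onEdge p q ≡ true → ∀ {γ′} → Orientation G∖e γ′ → Orientation G (add p q γ′)
  add-orientation {p} {q} pq {γ′} O = record { arc⇒edge = arc⇒edge′ ; edge⇒arc = edge⇒arc′ ; antisym = antisym′ }
    where
    open Orientation O
    arc⇒edge′ : ∀ {u v} → add p q γ′ u v ≡ true → adj G u v ≡ true
    arc⇒edge′ h with add-sound γ′ h
    ... | inj₁ (refl , refl) = onEdge-adj pq
    ... | inj₂ h′            = delete-⊆ (adj G) (arc⇒edge h′)
    edge⇒arc′ : ∀ {u v} → adj G u v ≡ true → add p q γ′ u v ≡ true ⊎ add p q γ′ v u ≡ true
    edge⇒arc′ {u} {v} e with onEdge? u v
    ... | inj₁ uv = Sum.map (add-⊇ γ′) (add-⊇ γ′) (edge⇒arc (∧-intro e (cong not uv)))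
    ... | inj₂ uv with same-edge {p} {q} {u} {v} pq uv
    ...   | inj₁ (refl , refl) = inj₁ (add-new p q γ′)
    ...   | inj₂ (refl , refl) = inj₂ (add-new p q γ′)
    antisym′ : ∀ {u v} → add p q γ′ u v ≡ true → add p q γ′ v u ≡ true → ⊥
    antisym′ h₁ h₂ with add-sound γ′ h₁ | add-sound γ′ h₂
    ... | inj₁ (refl , refl) | inj₁ (q≡p , _)   = onEdge-≢ pq (sym q≡p)
    ... | inj₁ (refl , refl) | inj₂ h            = not-¬ h (avoids-edge O (trans (onEdge-sym q p) pq))
    ... | inj₂ h             | inj₁ (refl , refl) = not-¬ h (avoids-edge O (trans (onEdge-sym q p) pq))
    ... | inj₂ h₁′           | inj₂ h₂′           = antisym h₁′ h₂′

  delete-add : ∀ {p q} → onEdge p q ≡ true → ∀ {γ′} → Orientation G∖e γ′ → delete (add p q γ′) ≐ γ′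
  delete-add {p} {q} pq {γ′} O u v with onEdge? u v
  ... | inj₂ uv = trans (delete-onEdge (add p q γ′) {u} {v} uv) (sym (avoids-edge O uv))
  ... | inj₁ uv = trans (delete-offEdge (add p q γ′) {u} {v} uv) (true-⇔⇒≡ old (add-⊇ γ′))
    where
    old : add p q γ′ u v ≡ true → γ′ u v ≡ true
    old h with add-sound γ′ h
    ... | inj₁ (refl , refl) = ⊥-elim (not-¬ pq uv)
    ... | inj₂ h′            = h′

  add-delete : ∀ {p q} → onEdge p q ≡ true → ∀ {γ} → γ p q ≡ true → γ q p ≡ false → add p q (delete γ) ≐ γ
  add-delete {p} {q} pq {γ} γpq γqp u v = true-⇔⇒≡ to from
    where
    to : add p q (delete γ) u v ≡ true → γ u v ≡ true
    to h with add-sound (delete γ) h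
    ... | inj₁ (refl , refl) = γpq
    ... | inj₂ h′            = delete-⊆ γ h′
    from : γ u v ≡ true → add p q (delete γ) u v ≡ true
    from h with onEdge? u v
    ... | inj₁ uv = add-⊇ (delete γ) (trans (delete-offEdge γ uv) h)
    ... | inj₂ uv with same-edge {p} {q} {u} {v} pq uv
    ...   | inj₁ (refl , refl) = add-new p q (delete γ)
    ...   | inj₂ (refl , refl) = ⊥-elim (not-¬ h γqp)

  one-direction : ∀ {γ} → Orientation G γ → γ w a ≡ not (γ a w)
  one-direction {γ} O with Orientation.edge⇒arc O edge | γ a w in aw | γ w a in wa
  ... | _        | true  | true  = ⊥-elim (Orientation.antisym O aw wa)
  ... | _        | true  | false = refl
  ... | _        | false | true  = refl
  ... | inj₁ aw′ | false | false = ⊥-elim (not-¬ aw′ aw)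
  ... | inj₂ wa′ | false | false = ⊥-elim (not-¬ wa′ wa)

  w→a-AO : Digraph (suc n) → Bool
  w→a-AO γ = isAcyclicOrientation G γ ∧ γ w a

  redundant-a→w-AO : Digraph (suc n) → Bool
  redundant-a→w-AO γ = isAcyclicOrientation G γ ∧ (γ a w ∧ reachB (delete γ) a w)

  essential-a→w-AO : Digraph (suc n) → Bool
  essential-a→w-AO γ = isAcyclicOrientation G γ ∧ (γ a w ∧ not (reachB (delete γ) a w))

  a↛w-AO : Digraph (suc n) → Bool
  a↛w-AO γ′ = isAcyclicOrientation G∖e γ′ ∧ not (reachB γ′ a w)

  a⇝w-AO : Digraph (suc n) → Bool
  a⇝w-AO γ′ = isAcyclicOrientation G∖e γ′ ∧ reachB γ′ a w

  private
    module AO {m : ℕ} (H : WGraph m) (γ : Digraph m) {b : Bool} (h : isAcyclicOrientation H γ ∧ b ≡ true) where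
      O : Orientation H γ
      O = proj₁ (isAcyclicOrientation-sound H γ (∧-elimˡ _ h))
      A : Acyclic γ
      A = proj₂ (isAcyclicOrientation-sound H γ (∧-elimˡ _ h))
      rest : b ≡ true
      rest = ∧-elimʳ (isAcyclicOrientation H γ) h

  w→a-from-to : ∀ {γ} → w→a-AO γ ≡ true → add w a (delete γ) ≐ γ
  w→a-from-to {γ} h = add-delete onEdge-wa (AO.rest G γ h) (¬-not λ γaw → Orientation.antisym (AO.O G γ h) γaw (AO.rest G γ h))

  w→a-bijection : SubsetBijection (Digraphs (suc n)) (Digraphs (suc n)) w→a-AO a↛w-AO
  w→a-bijection = record
    { to        = delete
    ; from      = add w a
    ; to-cong   = λ {γ} {γ′} → delete-≐ {γ} {γ′}
    ; from-cong = add-≐ w a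
    ; P-resp    = λ e → cong₂ _∧_ (isAcyclicOrientation-≐ e G) (e w a)
    ; Q-resp    = λ e → cong₂ (λ x y → x ∧ not y) (isAcyclicOrientation-≐ e G∖e) (reachB-≐ e a w)
    ; to-Q      = λ {γ} → to-Q {γ}
    ; from-P    = λ {γ′} → from-P {γ′}
    ; from-to   = λ {γ} → w→a-from-to {γ}
    ; to-from   = λ {γ′} h → delete-add onEdge-wa (AO.O G∖e γ′ h)
    }
    where
    to-Q : ∀ {γ} → w→a-AO γ ≡ true → a↛w-AO (delete γ) ≡ true
    to-Q {γ} h = ∧-intro
      (isAcyclicOrientation-complete G∖e (delete γ) (delete-orientation (AO.O G γ h)) (delete-acyclic (AO.A G γ h)))
      (cong not (¬-not λ r → AO.A G γ h a (mapWalk (delete-⊆ γ) (reachB-sound r) ◅◅ arc (AO.rest G γ h))))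
    from-P : ∀ {γ′} → a↛w-AO γ′ ≡ true → w→a-AO (add w a γ′) ≡ true
    from-P {γ′} h = ∧-intro (isAcyclicOrientation-complete G (add w a γ′) (add-orientation onEdge-wa (AO.O G∖e γ′ h)) acyclic)
                            (add-new w a γ′)
      where
      a↛w : ¬ Reach γ′ a w
      a↛w (inj₁ a≡w) = a≢w a≡w
      a↛w (inj₂ W)   = not-¬ (reachB-complete W) (not-injective (AO.rest G∖e γ′ h))
      acyclic : Acyclic (add w a γ′)
      acyclic i W with add-walk γ′ W
      ... | inj₁ W′          = AO.A G∖e γ′ h i W′
      ... | inj₂ (i⇝w , a⇝i) = a↛w (Reach-trans a⇝i i⇝w)

  w→a-sourceWeights : ∀ {γ} → w→a-AO γ ≡ true → sourceWeights G γ ≡ sourceWeights G∖e (delete γ)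
  w→a-sourceWeights {γ} h = sourceWeights-cong G G∖e γ (delete γ) (λ _ → refl) same-root
    where
    same-root : ∀ u → root γ u ≡ root (delete γ) u
    same-root u with reach? {o = delete γ} a u
    ... | yes a⇝u = trans (root-from-a (Orientation.arc⇒edge (AO.O G γ h)) (mapReach (delete-⊆ γ) a⇝u))
                          (sym (root-from-a (Orientation.arc⇒edge (AO.O G γ h) ∘ delete-⊆ γ) a⇝u))
    ... | no  a↛u = root-cong γ (delete γ) u avoid-w→a (mapReach (delete-⊆ γ))
      where
      avoid-w→a : ∀ {s} → Reach γ s u → Reach (delete γ) s u
      avoid-w→a (inj₁ s≡u) = inj₁ s≡u
      avoid-w→a (inj₂ W) with add-walk (delete γ) (walk-≐ (≐-sym (w→a-from-to h)) W)
      ... | inj₁ W′       = inj₂ W′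
      ... | inj₂ (_ , a⇝u) = ⊥-elim (a↛u a⇝u)

  redundant-a→w-from-to : ∀ {γ} → redundant-a→w-AO γ ≡ true → add a w (delete γ) ≐ γ
  redundant-a→w-from-to {γ} h =
    add-delete onEdge-aw (∧-elimˡ _ (AO.rest G γ h)) (¬-not λ γwa → Orientation.antisym (AO.O G γ h) (∧-elimˡ _ (AO.rest G γ h)) γwa)

  redundant-a→w-bijection : SubsetBijection (Digraphs (suc n)) (Digraphs (suc n)) redundant-a→w-AO a⇝w-AO
  redundant-a→w-bijection = record
    { to        = delete
    ; from      = add a w
    ; to-cong   = λ {γ} {γ′} → delete-≐ {γ} {γ′}
    ; from-cong = add-≐ a w
    ; P-resp    = λ e → cong₂ _∧_ (isAcyclicOrientation-≐ e G) (cong₂ _∧_ (e a w) (reachB-≐ (delete-≐ e) a w))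
    ; Q-resp    = λ e → cong₂ _∧_ (isAcyclicOrientation-≐ e G∖e) (reachB-≐ e a w)
    ; to-Q      = λ {γ} → to-Q {γ}
    ; from-P    = λ {γ′} → from-P {γ′}
    ; from-to   = λ {γ} → redundant-a→w-from-to {γ}
    ; to-from   = λ {γ′} h → delete-add onEdge-aw (AO.O G∖e γ′ h)
    }
    where
    to-Q : ∀ {γ} → redundant-a→w-AO γ ≡ true → a⇝w-AO (delete γ) ≡ true
    to-Q {γ} h = ∧-intro
      (isAcyclicOrientation-complete G∖e (delete γ) (delete-orientation (AO.O G γ h)) (delete-acyclic (AO.A G γ h)))
      (∧-elimʳ (γ a w) (AO.rest G γ h))
    from-P : ∀ {γ′} → a⇝w-AO γ′ ≡ true → redundant-a→w-AO (add a w γ′) ≡ true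
    from-P {γ′} h = ∧-intro (isAcyclicOrientation-complete G (add a w γ′) (add-orientation onEdge-aw (AO.O G∖e γ′ h)) acyclic)
                            (∧-intro (add-new a w γ′) (trans (reachB-≐ (delete-add onEdge-aw (AO.O G∖e γ′ h)) a w) (AO.rest G∖e γ′ h)))
      where
      acyclic : Acyclic (add a w γ′)
      acyclic i W with add-walk γ′ W
      ... | inj₁ W′          = AO.A G∖e γ′ h i W′
      ... | inj₂ (i⇝a , w⇝i) = AO.A G∖e γ′ h w (Reach⇒Walk (a≢w ∘ sym) (Reach-trans w⇝i i⇝a) ◅◅ reachB-sound (AO.rest G∖e γ′ h))

  redundant-a→w-sourceWeights : ∀ {γ} → redundant-a→w-AO γ ≡ true → sourceWeights G γ ≡ sourceWeights G∖e (delete γ)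
  redundant-a→w-sourceWeights {γ} h =
    sourceWeights-cong G G∖e γ (delete γ) (λ _ → refl) (λ u → root-cong γ (delete γ) u detour (mapReach (delete-⊆ γ)))
    where
    detour : ∀ {s u} → Reach γ s u → Reach (delete γ) s u
    detour (inj₁ s≡u) = inj₁ s≡u
    detour (inj₂ W) with add-walk (delete γ) (walk-≐ (≐-sym (redundant-a→w-from-to h)) W)
    ... | inj₁ W′          = inj₂ W′
    ... | inj₂ (s⇝a , w⇝u) = Reach-trans s⇝a (Reach-trans (inj₂ (reachB-sound (∧-elimʳ (γ a w) (AO.rest G γ h)))) w⇝u)

  module Essential {γ : Digraph (suc n)} (h : essential-a→w-AO γ ≡ true) where

    private
      O = AO.O G γ h
      A = AO.A G γ h

    γaw : γ a w ≡ true
    γaw = ∧-elimˡ _ (AO.rest G γ h)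

    γwa : γ w a ≡ false
    γwa = ¬-not (Orientation.antisym O γaw)

    δ : Digraph n
    δ = contract (delete γ)

    no-return : ∀ {x y} → π x ≡ α → π y ≡ α → ¬ Walk (delete γ) x y
    no-return πx≡α πy≡α W with π-fibre-α πx≡α | π-fibre-α πy≡α
    ... | inj₁ refl | inj₁ refl = delete-acyclic A a W
    ... | inj₁ refl | inj₂ refl = not-¬ (reachB-complete W) (not-injective (∧-elimʳ (γ a w) (AO.rest G γ h)))
    ... | inj₂ refl | inj₁ refl = A a (γaw ◅ mapWalk (delete-⊆ γ) W)
    ... | inj₂ refl | inj₂ refl = delete-acyclic A w W

    δ-acyclic : Acyclic δ
    δ-acyclic = contract-acyclic (delete γ) (delete-acyclic A) no-return

    δ-orientation : Orientation G/e δ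
    δ-orientation = record
      { arc⇒edge = contract-mono (Orientation.arc⇒edge (delete-orientation O))
      ; edge⇒arc = λ e → let _ , _ , πu≡i , πv≡j , e′ = contract-sound e in
                         Sum.map (contract-complete πu≡i πv≡j) (contract-complete πv≡j πu≡i)
                                 (Orientation.edge⇒arc (delete-orientation O) e′)
      ; antisym  = λ {i} h₁ h₂ → δ-acyclic i (h₁ ◅ arc h₂)
      }

    arcs-project : ∀ {u v} → γ u v ≡ true → (u ≡ a × v ≡ w) ⊎ δ (π u) (π v) ≡ true
    arcs-project {u} {v} e with onEdge? u v
    ... | inj₁ uv = inj₂ (contract-complete refl refl (trans (delete-offEdge γ uv) e))
    ... | inj₂ uv with onEdge-sound {u} {v} uv
    ...   | inj₁ u≡a×v≡w     = inj₁ u≡a×v≡w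
    ...   | inj₂ (refl , refl) = ⊥-elim (not-¬ e γwa)

    root-w : root γ w ≡ a
    root-w = root-from-a (Orientation.arc⇒edge O) (inj₂ (arc γaw))

    -- Either a reaches σ i, and then both roots come from a, or no walk into σ i passes through w.
    root-σ : ∀ i → root γ (σ i) ≡ σ (root δ i)
    root-σ i with reach? {o = γ} a (σ i)
    ... | yes a⇝σi = trans (root-from-a (Orientation.arc⇒edge O) a⇝σi) (sym (trans (cong σ root-α) σ-α))
      where
      α≤ : ∀ {s} → Reach δ s i → α ≤ s
      α≤ (inj₁ refl) = subst (α ≤_) (π-σ i) (α≤π (a≤reached (Orientation.arc⇒edge O) a⇝σi))
      α≤ (inj₂ W) = let k , e = first-arc W ; u , v , πu≡s , _ , e′ = contract-sound e in
                    subst (α ≤_) πu≡s (α≤π (a≤nonisolated (Orientation.arc⇒edge O (delete-⊆ γ e′))))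
      root-α : root δ i ≡ α
      root-α = root-unique δ (subst₂ (Reach δ) π-a (π-σ i) (project-reach-a→w arcs-project a⇝σi)) α≤
    ... | no a↛σi = root-unique γ σt⇝σi least
      where
      σt⇝σi : Reach γ (σ (root δ i)) (σ i)
      σt⇝σi with root-reaches δ i
      ... | inj₁ t≡i = inj₁ (cong σ t≡i)
      ... | inj₂ W = [ inj₂ , (λ a⇝σi → ⊥-elim (a↛σi a⇝σi)) ]′ (lift-walk (delete-⊆ γ) γaw W)
      least : ∀ {u} → Reach γ u (σ i) → σ (root δ i) ≤ u
      least {u} u⇝σi with u Fin.≟ w
      ... | yes refl = ⊥-elim (a↛σi (Reach-trans (inj₂ (arc γaw)) u⇝σi))
      ... | no  u≢w  = subst (σ (root δ i) ≤_) (σ-π u≢w)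
                         (Fin.punchIn-mono-≤ w _ _ (root-least δ (subst (Reach δ (π u)) (π-σ i) (project-reach-a→w arcs-project u⇝σi))))

    root-π : ∀ u → root γ u ≡ σ (root δ (π u))
    root-π u with u Fin.≟ w
    ... | no  u≢w  = trans (cong (root γ) (sym (σ-π u≢w))) (root-σ (π u))
    ... | yes refl = trans root-w (sym (trans (cong (σ ∘ root δ) π-w) (trans (cong σ root-α) σ-α)))
      where
      root-α : root δ α ≡ α
      root-α = σ-injective (trans (sym (root-σ α)) (trans (cong (root γ) σ-α) (trans (root-from-a (Orientation.arc⇒edge O) (inj₁ refl)) (sym σ-α))))

    from-to : add a w (lift δ) ≐ γ
    from-to u v = true-⇔⇒≡ to from
      where
      to : add a w (lift δ) u v ≡ true → γ u v ≡ true
      to e with add-sound (lift δ) e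
      ... | inj₁ (refl , refl) = γaw
      ... | inj₂ l with Orientation.edge⇒arc O (delete-⊆ (adj G) (∧-elimˡ _ l))
      ...   | inj₁ γuv = γuv
      ...   | inj₂ γvu = ⊥-elim (Orientation.antisym δ-orientation (∧-elimʳ (adj G∖e u v) l)
                           (contract-complete refl refl (∧-intro γvu (trans (cong not (onEdge-sym v u)) (∧-elimʳ (adj G u v) (∧-elimˡ _ l))))))
      from : γ u v ≡ true → add a w (lift δ) u v ≡ true
      from e with onEdge? u v
      ... | inj₁ uv = add-⊇ (lift δ) (∧-intro (trans (delete-offEdge (adj G) uv) (Orientation.arc⇒edge O e))
                                              (contract-complete refl refl (trans (delete-offEdge γ uv) e)))
      ... | inj₂ uv with onEdge-sound {u} {v} uv
      ...   | inj₁ (refl , refl) = add-new a w (lift δ)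
      ...   | inj₂ (refl , refl) = ⊥-elim (not-¬ e γwa)

    sourceWeights-contract : sourceWeights G γ ≡ sourceWeights G/e δ
    sourceWeights-contract = begin
      sourceWeights G γ                                                      ≡⟨ sourceWeights-components G γ ⟩
      map (componentWeight γ G) (filterᵇ (isRoot γ) (allFin (suc n)))        ≡⟨ cong (map _) (filterᵇ-allFin-punchIn w (isRoot γ) w-not-root) ⟩
      map (componentWeight γ G) (map σ (filterᵇ (isRoot γ ∘ σ) (allFin n)))  ≡⟨ map-∘ _ ⟨
      map (componentWeight γ G ∘ σ) (filterᵇ (isRoot γ ∘ σ) (allFin n))      ≡⟨ map-cong component-σ _ ⟩
      map (componentWeight δ G/e) (filterᵇ (isRoot γ ∘ σ) (allFin n))        ≡⟨ cong (map _) (filterᵇ-cong isRoot-σ (allFin n)) ⟩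
      map (componentWeight δ G/e) (filterᵇ (isRoot δ) (allFin n))            ≡⟨ sourceWeights-components G/e δ ⟨
      sourceWeights G/e δ                                                    ∎
      where
      open ≡-Reasoning
      ==-σ : ∀ i j → (σ i == σ j) ≡ (i == j)
      ==-σ i j = true-⇔⇒≡ (λ e → ==-complete (σ-injective (==-sound _ _ e))) (λ e → ==-complete (cong σ (==-sound _ _ e)))
      w-not-root : isRoot γ w ≡ false
      w-not-root = trans (cong (_== w) root-w) (==-false a≢w)
      isRoot-σ : ∀ i → isRoot γ (σ i) ≡ isRoot δ i
      isRoot-σ i = trans (cong (_== σ i) (root-σ i)) (==-σ _ _)
      component-σ : ∀ s → componentWeight γ G (σ s) ≡ componentWeight δ G/e s
      component-σ s = trans (cong (sumℕ ∘ map (weight G)) (filterᵇ-cong (λ u → trans (cong (_== σ s) (root-π u)) (==-σ _ _)) (allFin (suc n))))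
                            (sym (fibres-weight (λ i → root δ i == s)))

  module Contracted {δ : Digraph n} (h : isAcyclicOrientation G/e δ ≡ true) where

    private
      O = proj₁ (isAcyclicOrientation-sound G/e δ h)
      A = proj₂ (isAcyclicOrientation-sound G/e δ h)

    lift-orientation : Orientation G∖e (lift δ)
    lift-orientation = record
      { arc⇒edge = λ {u} {v} → ∧-elimˡ (adj G∖e u v)
      ; edge⇒arc = λ {u} {v} e → Sum.map (∧-intro e) (∧-intro (trans (adj-sym G∖e v u) e))
                                         (Orientation.edge⇒arc O (contract-complete refl refl e))
      ; antisym  = λ {u} {v} h₁ h₂ → Orientation.antisym O (∧-elimʳ (adj G∖e u v) h₁) (∧-elimʳ (adj G∖e v u) h₂)
      }

    γ : Digraph (suc n)
    γ = add a w (lift δ)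

    γ-acyclic : Acyclic γ
    γ-acyclic u W with project-walk-a→w arcs-project W
      where
      arcs-project : ∀ {u v} → γ u v ≡ true → (u ≡ a × v ≡ w) ⊎ δ (π u) (π v) ≡ true
      arcs-project {u} {v} e = Sum.map₂ (∧-elimʳ (adj G∖e u v)) (add-sound (lift δ) e)
    ... | inj₁ W′          = A (π u) W′
    ... | inj₂ (refl , a≡w) = a≢w a≡w

    delete-γ : delete γ ≐ lift δ
    delete-γ = delete-add onEdge-aw lift-orientation

    a↛w : ¬ Walk (delete γ) a w
    a↛w W = A α (subst₂ (Walk δ) π-a π-w (project-walk (λ {u} {v} → ∧-elimʳ (adj G∖e u v)) (walk-≐ delete-γ W)))

    from-P : essential-a→w-AO γ ≡ true
    from-P = ∧-intro (isAcyclicOrientation-complete G γ (add-orientation onEdge-aw lift-orientation) γ-acyclic)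
                     (∧-intro (add-new a w (lift δ)) (cong not (¬-not (a↛w ∘ reachB-sound))))

    to-from : contract (delete γ) ≐ δ
    to-from i j = trans (contract-≐ delete-γ i j) (true-⇔⇒≡ to from)
      where
      to : contract (lift δ) i j ≡ true → δ i j ≡ true
      to e = let u , v , πu≡i , πv≡j , l = contract-sound e in
             subst₂ (λ x y → δ x y ≡ true) πu≡i πv≡j (∧-elimʳ (adj G∖e u v) l)
      from : δ i j ≡ true → contract (lift δ) i j ≡ true
      from d = let u , v , πu≡i , πv≡j , e = contract-sound (Orientation.arc⇒edge O d) in
               contract-complete πu≡i πv≡j (∧-intro e (subst₂ (λ x y → δ x y ≡ true) (sym πu≡i) (sym πv≡j) d))

  essential-a→w-bijection : SubsetBijection (Digraphs (suc n)) (Digraphs n) essential-a→w-AO (isAcyclicOrientation G/e)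
  essential-a→w-bijection = record
    { to        = contract ∘ delete
    ; from      = add a w ∘ lift
    ; to-cong   = λ e → contract-≐ (delete-≐ e)
    ; from-cong = λ e → add-≐ a w (lift-≐ e)
    ; P-resp    = λ e → cong₂ _∧_ (isAcyclicOrientation-≐ e G) (cong₂ _∧_ (e a w) (cong not (reachB-≐ (delete-≐ e) a w)))
    ; Q-resp    = λ e → isAcyclicOrientation-≐ e G/e
    ; to-Q      = λ {γ} h → isAcyclicOrientation-complete G/e _ (Essential.δ-orientation {γ} h) (Essential.δ-acyclic {γ} h)
    ; from-P    = λ {δ} h → Contracted.from-P {δ} h
    ; from-to   = λ {γ} h → Essential.from-to {γ} h
    ; to-from   = λ {δ} h → Contracted.to-from {δ} h
    }

Colourings : ℕ → ℕ → DecSetoid _ _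
Colourings N m = Pointwise.decSetoid (Fin.≡-decSetoid N) m

Proper : ∀ {m N} → WGraph m → (Fin m → Fin N) → Set
Proper H κ = ∀ {i j} → adj H i j ≡ true → κ i ≢ κ j

module _ {m N : ℕ} (H : WGraph m) (κ : Fin m → Fin N) where

  isProper-sound : isProper H κ ≡ true → Proper H κ
  isProper-sound h {i} {j} e κi≡κj =
    not-¬ (allB-elim _ (allB-elim _ h i) j) (cong₂ (λ b c → not (b ∧ c)) e (==-complete κi≡κj))

  isProper-complete : Proper H κ → isProper H κ ≡ true
  isProper-complete proper = allB-intro _ λ i → allB-intro _ λ j → pair i j
    where
    pair : ∀ i j → not (adj H i j ∧ (κ i == κ j)) ≡ true
    pair i j with adj H i j in e
    ... | true  = cong not (==-false (proper e))
    ... | false = refl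

isProper-≗ : ∀ {m N} (H : WGraph m) {κ κ′ : Fin m → Fin N} → (∀ i → κ i ≡ κ′ i) → isProper H κ ≡ isProper H κ′
isProper-≗ H κ≗κ′ = allB-cong λ i → allB-cong λ j → cong₂ (λ x y → not (adj H i j ∧ (x == y))) (κ≗κ′ i) (κ≗κ′ j)

module ProperColourings {n N : ℕ} (E : FirstEdge n) where

  open Contraction E

  isProper-G : ∀ (κ : Fin (suc n) → Fin N) → isProper G κ ≡ isProper G∖e κ ∧ not (κ a == κ w)
  isProper-G κ = true-⇔⇒≡ to from
    where
    to : isProper G κ ≡ true → isProper G∖e κ ∧ not (κ a == κ w) ≡ true
    to h = ∧-intro (isProper-complete G∖e κ (isProper-sound G κ h ∘ delete-⊆ (adj G)))
                   (cong not (==-false (isProper-sound G κ h edge)))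
    from : isProper G∖e κ ∧ not (κ a == κ w) ≡ true → isProper G κ ≡ true
    from h = isProper-complete G κ proper
      where
      κa≢κw : κ a ≢ κ w
      κa≢κw κa≡κw = not-¬ (∧-elimʳ (isProper G∖e κ) h) (cong not (==-complete κa≡κw))
      proper : Proper G κ
      proper {i} {j} e with onEdge? i j
      ... | inj₁ ij = isProper-sound G∖e κ (∧-elimˡ _ h) (trans (delete-offEdge (adj G) ij) e)
      ... | inj₂ ij with onEdge-sound {i} {j} ij
      ...   | inj₁ (refl , refl) = κa≢κw
      ...   | inj₂ (refl , refl) = κa≢κw ∘ sym

  monochromatic-edge : (Fin (suc n) → Fin N) → Bool
  monochromatic-edge κ = isProper G∖e κ ∧ (κ a == κ w)

  collapse : ∀ {κ : Fin (suc n) → Fin N} → κ a ≡ κ w → ∀ u → κ (σ (π u)) ≡ κ u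
  collapse {κ} κa≡κw u with u Fin.≟ w
  ... | yes refl = trans (cong (κ ∘ σ) π-w) (trans (cong κ σ-α) κa≡κw)
  ... | no  u≢w  = cong κ (σ-π u≢w)

  colouring-bijection : SubsetBijection (Colourings N (suc n)) (Colourings N n) monochromatic-edge (isProper G/e)
  colouring-bijection = record
    { to        = _∘ σ
    ; from      = _∘ π
    ; to-cong   = λ e → e ∘ σ
    ; from-cong = λ e → e ∘ π
    ; P-resp    = λ e → cong₂ _∧_ (isProper-≗ G∖e e) (cong₂ _==_ (e a) (e w))
    ; Q-resp    = isProper-≗ G/e
    ; to-Q      = λ {κ} h → isProper-complete G/e (κ ∘ σ) (to-proper h)
    ; from-P    = λ {κ′} h → ∧-intro (isProper-complete G∖e (κ′ ∘ π) (from-proper h)) (==-complete (cong κ′ (trans π-a (sym π-w))))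
    ; from-to   = λ {κ} h → collapse {κ} (==-sound _ _ (∧-elimʳ (isProper G∖e κ) h))
    ; to-from   = λ {κ′} _ i → cong κ′ (π-σ i)
    }
    where
    to-proper : ∀ {κ} → monochromatic-edge κ ≡ true → Proper G/e (κ ∘ σ)
    to-proper {κ} h e =
      let u , v , πu≡i , πv≡j , e′ = contract-sound e
          same = collapse {κ} (==-sound _ _ (∧-elimʳ (isProper G∖e κ) h))
      in λ κσi≡κσj → isProper-sound G∖e κ (∧-elimˡ _ h) e′
           (trans (sym (same u)) (trans (cong (κ ∘ σ) πu≡i) (trans κσi≡κσj (trans (cong (κ ∘ σ) (sym πv≡j)) (same v)))))
    from-proper : ∀ {κ′} → isProper G/e κ′ ≡ true → Proper G∖e (κ′ ∘ π)
    from-proper {κ′} h e = isProper-sound G/e κ′ h (contract-complete refl refl e)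

Edgeless : ∀ {m} → WGraph m → Set
Edgeless H = ∀ u v → adj H u v ≡ false

∅ : ∀ {m} → Digraph m
∅ _ _ = false

module _ {m : ℕ} (H : WGraph m) (no-edges : Edgeless H) where

  edgeless-AO : ∀ γ → isAcyclicOrientation H γ ≡ does (DecSetoid._≟_ (Digraphs m) ∅ γ)
  edgeless-AO γ = true-⇔⇒≡ (dec-true (DecSetoid._≟_ (Digraphs m) ∅ γ) ∘ no-arcs)
                           (no-arcs⇒AO ∘ does-sound (DecSetoid._≟_ (Digraphs m) ∅ γ))
    where
    no-arcs : isAcyclicOrientation H γ ≡ true → ∅ ≐ γ
    no-arcs h i j = sym (¬-not λ e → not-¬ (Orientation.arc⇒edge (proj₁ (isAcyclicOrientation-sound H γ h)) e) (no-edges i j))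
    no-arcs⇒AO : ∅ ≐ γ → isAcyclicOrientation H γ ≡ true
    no-arcs⇒AO ∅≐γ = isAcyclicOrientation-complete H γ orientation acyclic
      where
      no-arc : ∀ {i j} → γ i j ≢ true
      no-arc {i} {j} = not-¬ (sym (∅≐γ i j))
      orientation : Orientation H γ
      orientation = record
        { arc⇒edge = ⊥-elim ∘ no-arc
        ; edge⇒arc = λ {i} {j} e → ⊥-elim (not-¬ e (no-edges i j))
        ; antisym  = λ e _ → no-arc e
        }
      acyclic : Acyclic γ
      acyclic i W = no-arc (proj₂ (first-arc W))

  edgeless-sourceWeights : sourceWeights H ∅ ≡ map (weight H) (allFin m)
  edgeless-sourceWeights = begin
    sourceWeights H ∅
      ≡⟨ sourceWeights-components H ∅ ⟩
    map (componentWeight ∅ H) (filterᵇ (isRoot ∅) (allFin m))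
      ≡⟨ cong (map _) (filterᵇ-cong (λ s → trans (cong (_== s) (root-∅ s)) (==-refl s)) (allFin m)) ⟩
    map (componentWeight ∅ H) (filterᵇ (λ _ → true) (allFin m))
      ≡⟨ cong (map _) (filter-all (T? ∘ (λ _ → true)) (All.universal _ (allFin m))) ⟩
    map (componentWeight ∅ H) (allFin m)
      ≡⟨ map-cong singleton-component (allFin m) ⟩
    map (weight H) (allFin m) ∎
    where
    open ≡-Reasoning
    root-∅ : ∀ u → root ∅ u ≡ u
    root-∅ u = root-unique ∅ (inj₁ refl) λ { (inj₁ refl) → Fin.≤-refl ; (inj₂ W) → ⊥-elim (not-¬ (proj₂ (first-arc W)) refl) }
    singleton-component : ∀ s → componentWeight ∅ H s ≡ weight H s
    singleton-component s =
      trans (ℕsum.∑-filterᵇ _ (weight H) (allFin m))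
     (trans (ℕsum.∑-single s _ (λ u u≢s → cong (if_then weight H u else 0) (trans (cong (_== s) (root-∅ u)) (==-false u≢s))))
              (cong (if_then weight H s else 0) (trans (cong (_== s) (root-∅ s)) (==-refl s))))

first-edge : ∀ {n} (H : WGraph (suc n)) → Edgeless H ⊎ Σ (FirstEdge n) (λ E → FirstEdge.G E ≡ H)
first-edge H with anyB (λ s → anyB (adj H s)) in has-edge
... | false = inj₁ λ u v → ¬-not λ e → not-¬ (anyB-intro _ u (anyB-intro (adj H u) v e)) has-edge
... | true =
  let _ , nonisolated = anyB-elim (λ s → anyB (adj H s)) has-edge
      a , a-nonisolated , a-least = least-satisfying {P = λ s → anyB (adj H s) ≡ true} (λ s → anyB (adj H s) Bool.≟ true) nonisolated
      w , edge = anyB-elim (adj H a) a-nonisolated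
  in inj₂ (record { G = H ; a = a ; w = w ; edge = edge
                  ; isolated-below-a = λ u v<a → ¬-not λ e → ℕ.<⇒≱ v<a (a-least (anyB-intro (adj H _) u e)) } , refl)

edges : ∀ {m} → WGraph m → ℕ
edges {m} H = ℕsum.∑ (λ u → ℕsum.∑ (λ v → if adj H u v then 1 else 0) (allFin m)) (allFin m)

deletion-fewer-edges : ∀ {n} (E : FirstEdge n) → edges (Contraction.G∖e E) ℕ.< edges (FirstEdge.G E)
deletion-fewer-edges E = ∑-mono-< (λ u → ∑-mono-≤ (fewer u) (allFin _)) a (∑-mono-< (fewer a) w gone)
  where
  open Contraction E
  fewer : ∀ u v → (if adj G∖e u v then 1 else 0) ℕ.≤ (if adj G u v then 1 else 0)
  fewer u v with adj G u v
  ... | true  with not (onEdge u v)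
  ...   | true  = ℕ.≤-refl
  ...   | false = ℕ.z≤n
  fewer u v | false = ℕ.≤-refl
  gone : (if adj G∖e a w then 1 else 0) ℕ.< (if adj G a w then 1 else 0)
  gone = subst₂ (λ b c → (if b then 1 else 0) ℕ.< (if c then 1 else 0))
                  (sym (delete-onEdge (adj G) onEdge-aw)) (sym edge) (ℕ.s≤s ℕ.z≤n)

deletion-contraction-induction : ∀ {p} (P : ∀ {m} → WGraph m → Set p) →
  (∀ {m} (H : WGraph m) → Edgeless H → P H) →
  (∀ {n} (E : FirstEdge n) → P (Contraction.G∖e E) → P (Contraction.G/e E) → P (FirstEdge.G E)) →
  ∀ {m} (H : WGraph m) → P H
deletion-contraction-induction P base step {zero}  H = base H (λ ())
deletion-contraction-induction P base step {suc n} H = by-edges (edges H) H ℕ.≤-refl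
  where
  by-edges : ∀ k (H : WGraph (suc n)) → edges H ℕ.≤ k → P H
  by-edges k H edges≤k with first-edge H
  ... | inj₁ no-edges = base H no-edges
  ... | inj₂ (E , refl) with k
  ...   | zero  = ⊥-elim (ℕ.n≮0 (ℕ.<-≤-trans (deletion-fewer-edges E) edges≤k))
  ...   | suc k′ = step E (by-edges k′ _ (ℕ.≤-pred (ℕ.<-≤-trans (deletion-fewer-edges E) edges≤k)))
                          (deletion-contraction-induction P base step (Contraction.G/e E))

module Expansions {c ℓ : Level} (R : CommutativeRing c ℓ) {N : ℕ} (x : Fin N → CommutativeRing.Carrier R) where

  open CommutativeRing R hiding (zero) renaming (refl to ≈-refl; sym to ≈-sym; trans to ≈-trans)
  open RingSum R
  open import Relation.Binary.Reasoning.Setoid setoid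
  open import Algebra.Properties.Ring ring using (-1*x≈-x)

  monomial : ∀ {m} → WGraph m → (Fin m → Fin N) → Carrier
  monomial {m} H κ = ∏ (λ v → pow R (x (κ v)) (weight H v)) (allFin m)

  monomial-≗ : ∀ {m} (H : WGraph m) {κ κ′} → (∀ i → κ i ≡ κ′ i) → monomial H κ ≈ monomial H κ′
  monomial-≗ {m} H κ≗κ′ = ∏-cong (allFin m) (λ v → reflexive (cong (λ c → pow R (x c) (weight H v)) (κ≗κ′ v)))

  properSum : ∀ {m} → WGraph m → Carrier
  properSum {m} H = ∑ (λ κ → ind (isProper H κ) * monomial H κ) (funs m (allFin N))

  chromSym≈properSum : ∀ {m} (H : WGraph m) → chromSym R H x ≈ properSum H
  chromSym≈properSum {m} H = ∑-filterᵇ-ind (isProper H) (monomial H) (funs m (allFin N))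

  colourings-enumerate : ∀ m → Enumerates (Colourings N m) (funs m (allFin N))
  colourings-enumerate = funs-enumerates (Fin.≡-decSetoid N) (allFin-enumerates N)

  module _ {n : ℕ} (E : FirstEdge n) where

    open Contraction E
    open ProperColourings {N = N} E

    monomial-contract : ∀ {κ} → κ a ≡ κ w → monomial G κ ≈ monomial G/e (κ ∘ σ)
    monomial-contract {κ} κa≡κw = begin
      ∏ (λ u → pow R (x (κ u)) (weight G u)) (allFin (suc n))
        ≈⟨ ∏-cong (allFin (suc n)) (λ u → reflexive (cong (λ c → pow R (x c) (weight G u)) (collapse κa≡κw u))) ⟨
      ∏ (λ u → pow R (x (κ (σ (π u)))) (weight G u)) (allFin (suc n))
        ≈⟨ ∏-fibres π (λ i u → pow R (x (κ (σ i))) (weight G u)) ⟨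
      ∏ (λ i → ∏ (λ u → pow R (x (κ (σ i))) (weight G u)) (fibre i)) (allFin n)
        ≈⟨ ∏-cong (allFin n) (λ i → pow-sumℕ (x (κ (σ i))) (weight G) (fibre i)) ⟨
      ∏ (λ i → pow R (x (κ (σ i))) (weight G/e i)) (allFin n) ∎

    properSum-deletion : properSum G∖e ≈ properSum G + properSum G/e
    properSum-deletion = begin
      properSum G∖e
        ≈⟨ ∑-split (funs (suc n) (allFin N)) (λ κ → ≈-trans (ind-split (isProper G∖e κ) (κ a == κ w))
                                                         (+-congʳ (reflexive (cong ind (sym (isProper-G κ)))))) ⟩
      properSum G + ∑ (λ κ → ind (monochromatic-edge κ) * monomial G κ) (funs (suc n) (allFin N))
        ≈⟨ +-congˡ (∑-bijection colouring-bijection (funs (suc n) (allFin N)) (funs n (allFin N))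
                                (colourings-enumerate (suc n)) (colourings-enumerate n)
                                (monomial-≗ G/e) (λ {κ} h → monomial-contract (==-sound _ _ (∧-elimʳ (isProper G∖e κ) h)))) ⟩
      properSum G + properSum G/e ∎

    chromSym-deletion-contraction : chromSym R G x ≈ chromSym R G∖e x + - chromSym R G/e x
    chromSym-deletion-contraction = begin
      chromSym R G x                       ≈⟨ chromSym≈properSum G ⟩
      properSum G                          ≈⟨ x≈y+z⇒y≈x-z properSum-deletion ⟩
      properSum G∖e + - properSum G/e      ≈⟨ +-cong (chromSym≈properSum G∖e) (-‿cong (chromSym≈properSum G/e)) ⟨
      chromSym R G∖e x + - chromSym R G/e x ∎

  signedPower : List ℕ → Carrier
  signedPower λ′ = sgn R (length λ′) * pPart R x λ′

  aoSum : ∀ {m} → WGraph m → Carrier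
  aoSum {m} H = ∑ (λ γ → ind (isAcyclicOrientation H γ) * signedPower (sourceWeights H γ)) (funs m (funs m bools))

  aoExpansion≈aoSum : ∀ {m} (H : WGraph m) → aoExpansion R H x ≈ sgn R m * aoSum H
  aoExpansion≈aoSum {m} H = *-congˡ (∑-filterᵇ-ind (isAcyclicOrientation H) _ (funs m (funs m bools)))

  digraphs-enumerate : ∀ m → Enumerates (Digraphs m) (funs m (funs m bools))
  digraphs-enumerate m = funs-enumerates (Pointwise.decSetoid Bool.≡-decSetoid m) (funs-enumerates Bool.≡-decSetoid bools-enumerates m) m

  signedPower-≐ : ∀ {m} (H : WGraph m) {γ γ′} → γ ≐ γ′ → signedPower (sourceWeights H γ) ≈ signedPower (sourceWeights H γ′)
  signedPower-≐ H γ≐γ′ = reflexive (cong signedPower (sourceWeights-≐ H γ≐γ′))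

  module _ {n : ℕ} (E : FirstEdge n) where

    open Contraction E
    open DeletionContraction E

    private
      F : ∀ {m} → WGraph m → Digraph m → Carrier
      F H γ = signedPower (sourceWeights H γ)

      split-G : ∀ γ → ind (isAcyclicOrientation G γ) ≈ ind (w→a-AO γ) + (ind (redundant-a→w-AO γ) + ind (essential-a→w-AO γ))
      split-G γ with isAcyclicOrientation G γ in ao
      ... | false = ≈-sym (≈-trans (+-identityˡ _) (+-identityˡ 0#))
      ... | true rewrite one-direction (proj₁ (isAcyclicOrientation-sound G γ ao)) with γ a w | reachB (delete γ) a w
      ...   | true  | true  = ≈-sym (≈-trans (+-identityˡ _) (+-identityʳ 1#))
      ...   | true  | false = ≈-sym (≈-trans (+-identityˡ _) (+-identityˡ 1#))
      ...   | false | _     = ≈-sym (≈-trans (+-congˡ (+-identityˡ 0#)) (+-identityʳ 1#))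

      split-G∖e : ∀ γ′ → ind (isAcyclicOrientation G∖e γ′) ≈ ind (a↛w-AO γ′) + ind (a⇝w-AO γ′)
      split-G∖e γ′ = ind-split (isAcyclicOrientation G∖e γ′) (reachB γ′ a w)

    aoSum-deletion-contraction : aoSum G ≈ aoSum G∖e + aoSum G/e
    aoSum-deletion-contraction = begin
      aoSum G
        ≈⟨ ∑-split D₁ split-G ⟩
      ∑ (λ γ → ind (w→a-AO γ) * F G γ) D₁ + ∑ (λ γ → (ind (redundant-a→w-AO γ) + ind (essential-a→w-AO γ)) * F G γ) D₁
        ≈⟨ +-congˡ (∑-split D₁ (λ _ → ≈-refl)) ⟩
      ∑ (λ γ → ind (w→a-AO γ) * F G γ) D₁ +
        (∑ (λ γ → ind (redundant-a→w-AO γ) * F G γ) D₁ + ∑ (λ γ → ind (essential-a→w-AO γ) * F G γ) D₁)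
        ≈⟨ +-cong (∑-bijection w→a-bijection D₁ D₁ (digraphs-enumerate (suc n)) (digraphs-enumerate (suc n))
                              (signedPower-≐ G∖e) (reflexive ∘ cong signedPower ∘ w→a-sourceWeights))
                  (+-cong (∑-bijection redundant-a→w-bijection D₁ D₁ (digraphs-enumerate (suc n)) (digraphs-enumerate (suc n))
                                       (signedPower-≐ G∖e) (reflexive ∘ cong signedPower ∘ redundant-a→w-sourceWeights))
                          (∑-bijection essential-a→w-bijection D₁ (funs n (funs n bools)) (digraphs-enumerate (suc n)) (digraphs-enumerate n)
                                       (signedPower-≐ G/e) (reflexive ∘ cong signedPower ∘ Essential.sourceWeights-contract))) ⟩
      ∑ (λ γ′ → ind (a↛w-AO γ′) * F G∖e γ′) D₁ + (∑ (λ γ′ → ind (a⇝w-AO γ′) * F G∖e γ′) D₁ + aoSum G/e)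
        ≈⟨ +-assoc _ _ _ ⟨
      (∑ (λ γ′ → ind (a↛w-AO γ′) * F G∖e γ′) D₁ + ∑ (λ γ′ → ind (a⇝w-AO γ′) * F G∖e γ′) D₁) + aoSum G/e
        ≈⟨ +-congʳ (∑-split D₁ split-G∖e) ⟨
      aoSum G∖e + aoSum G/e ∎
      where D₁ = funs (suc n) (funs (suc n) bools)

    aoExpansion-deletion-contraction : aoExpansion R G x ≈ aoExpansion R G∖e x + - aoExpansion R G/e x
    aoExpansion-deletion-contraction = begin
      aoExpansion R G x                                        ≈⟨ aoExpansion≈aoSum G ⟩
      sgn R (suc n) * aoSum G                                  ≈⟨ *-congˡ aoSum-deletion-contraction ⟩
      sgn R (suc n) * (aoSum G∖e + aoSum G/e)                  ≈⟨ distribˡ _ _ _ ⟩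
      sgn R (suc n) * aoSum G∖e + (- 1# * sgn R n) * aoSum G/e ≈⟨ +-cong (≈-sym (aoExpansion≈aoSum G∖e)) (≈-trans (*-assoc _ _ _) (-1*x≈-x _)) ⟩
      aoExpansion R G∖e x + - (sgn R n * aoSum G/e)            ≈⟨ +-congˡ (-‿cong (aoExpansion≈aoSum G/e)) ⟨
      aoExpansion R G∖e x + - aoExpansion R G/e x              ∎

  module _ {m : ℕ} (H : WGraph m) (no-edges : Edgeless H) where

    powerProduct : Carrier
    powerProduct = ∏ (λ v → pSum R x (weight H v)) (allFin m)

    chromSym-edgeless : chromSym R H x ≈ powerProduct
    chromSym-edgeless = begin
      chromSym R H x                      ≈⟨ chromSym≈properSum H ⟩
      properSum H                         ≈⟨ ∑-cong (funs m (allFin N)) (λ κ → ≈-trans (*-congʳ (reflexive (cong ind (every-proper κ)))) (*-identityˡ _)) ⟩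
      ∑ (monomial H) (funs m (allFin N))  ≈⟨ ∑-funs-∏ m (λ v c → pow R (x c) (weight H v)) (allFin N) ⟩
      powerProduct                        ∎
      where
      every-proper : ∀ κ → isProper H κ ≡ true
      every-proper κ = isProper-complete H κ (λ {i} {j} e → ⊥-elim (not-¬ e (no-edges i j)))

    aoExpansion-edgeless : aoExpansion R H x ≈ powerProduct
    aoExpansion-edgeless = begin
      aoExpansion R H x                 ≈⟨ aoExpansion≈aoSum H ⟩
      sgn R m * aoSum H                 ≈⟨ *-congˡ (∑-cong D (λ γ → *-congʳ (reflexive (cong ind (edgeless-AO H no-edges γ))))) ⟩
      sgn R m * ∑ (λ γ → ind (does (DecSetoid._≟_ (Digraphs m) ∅ γ)) * signedPower (sourceWeights H γ)) D
                                        ≈⟨ *-congˡ (∑-δ (Digraphs m) D (digraphs-enumerate m) (signedPower-≐ H) ∅) ⟩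
      sgn R m * signedPower (sourceWeights H ∅)
                                        ≡⟨ cong (λ ws → sgn R m * signedPower ws) (edgeless-sourceWeights H no-edges) ⟩
      sgn R m * (sgn R (length (map (weight H) (allFin m))) * prodR R (map (pSum R x) (map (weight H) (allFin m))))
                                        ≡⟨ cong₂ (λ k p → sgn R m * (sgn R k * p)) (trans (length-map (weight H) (allFin m)) (length-tabulate {n = m} (λ i → i)))
                                                                                    (cong (prodR R) (sym (map-∘ (allFin m)))) ⟩
      sgn R m * (sgn R m * powerProduct) ≈⟨ *-assoc _ _ _ ⟨
      (sgn R m * sgn R m) * powerProduct ≈⟨ *-congʳ (sgn-sq m) ⟩
      1# * powerProduct                  ≈⟨ *-identityˡ _ ⟩
      powerProduct                       ∎
      where D = funs m (funs m bools)

lemma5p1 : ∀ {c ℓ : Level} (R : CommutativeRing c ℓ) (n : ℕ) (G : WGraph n)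
    (N : ℕ) (x : Fin N → CommutativeRing.Carrier R) →
    CommutativeRing._≈_ R (chromSym R G x) (aoExpansion R G x)
lemma5p1 R n G N x = deletion-contraction-induction Agrees edgeless step G
  where
  open CommutativeRing R renaming (refl to ≈-refl; sym to ≈-sym; trans to ≈-trans)
  open Expansions R x
  open import Relation.Binary.Reasoning.Setoid setoid
  Agrees : ∀ {m} → WGraph m → Set _
  Agrees H = chromSym R H x ≈ aoExpansion R H x
  edgeless : ∀ {m} (H : WGraph m) → Edgeless H → Agrees H
  edgeless H no-edges = ≈-trans (chromSym-edgeless H no-edges) (≈-sym (aoExpansion-edgeless H no-edges))
  step : ∀ {m} (E : FirstEdge m) → Agrees (Contraction.G∖e E) → Agrees (Contraction.G/e E) → Agrees (FirstEdge.G E)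
  step E deleted contracted = begin
    chromSym R E.G x                                ≈⟨ chromSym-deletion-contraction E ⟩
    chromSym R E.G∖e x + - chromSym R E.G/e x       ≈⟨ +-cong deleted (-‿cong contracted) ⟩
    aoExpansion R E.G∖e x + - aoExpansion R E.G/e x ≈⟨ aoExpansion-deletion-contraction E ⟨
    aoExpansion R E.G x                             ∎
    where module E = Contraction E
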